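{- Let $n\ge 3$ and $m=n-2$. The minimal resistance distance between two distinct vertices of the straight linear 2-tree on $n$ vertices is \[ r_m\!\left(\tfrac n2,\tfrac n2+1\right)=\frac{F_{n-1}}{L_{n-1}}\quad\text{if } n \text{ is even}, \] \[ r_m\!\left(\tfrac{n-1}{2},\tfrac{n+1}{2}\right)=r_m\!\left(\tfrac{n+1}{2},\tfrac{n+3}{2}\right)=\frac{F_{n-1}}{L_{n-1}}+\frac{1}{F_{2n-2}}\quad\text{if } n\text{ is odd}. \]
   Context: $r_m(a,b)$ is the resistance distance between vertices $a,b$ of the straight linear 2-tree on $n=m+2$ vertices (vertex set $\{1,\dots,n\}$, $\{a,b\}$ an edge iff $0<|a-b|\le2$), with unit resistors on all edges: $r_m(a,b)=(\mathbf e_a-\mathbf e_b)^TL^{\dagger}(\mathbf e_a-\mathbf e_b)$, $L^\dagger$ the Moore–Penrose inverse of the Laplacian. $F_p$ are the Fibonacci numbers ($F_0=0,F_1=1,F_{p+1}=F_p+F_{p-1}$) and $L_p=F_{p-1}+F_{p+1}$ the Lucas numbers. -}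

module Defs where

open import Data.Nat as ℕ using (ℕ; zero; suc; _∸_; _≡ᵇ_; _<ᵇ_; _≤ᵇ_; ∣_-_∣)
open import Data.Bool using (Bool; true; false; if_then_else_; _∧_)
open import Data.Fin using (Fin; toℕ)
open import Data.Integer using (+_)
open import Data.Rational using (ℚ; 0ℚ; 1ℚ; _+_; _*_; -_; _-_; _/_)
open import Relation.Binary.PropositionalEquality using (_≡_)
open import Data.Product using (_×_)

fib : ℕ → ℕ
fib zero = 0
fib (suc zero) = 1
fib (suc (suc p)) = fib (suc p) ℕ.+ fib p

-- Lucas numbers L_p = F_{p-1} + F_{p+1}  (valid for p ≥ 1; only used for p ≥ 2)
lucas : ℕ → ℕ
lucas p = fib (p ∸ 1) ℕ.+ fib (suc p)

fib-suc-pos : ∀ p → 1 ℕ.≤ fib (suc p)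
fib-suc-pos zero = ℕ.s≤s ℕ.z≤n
fib-suc-pos (suc p) = ℕ.≤-trans (fib-suc-pos p) (ℕ.m≤m+n (fib (suc p)) (fib p))
  where import Data.Nat.Properties as ℕ

fib-suc-nonZero : ∀ p → ℕ.NonZero (fib (suc p))
fib-suc-nonZero p = ℕ.>-nonZero (fib-suc-pos p)

lucas-nonZero : ∀ p → ℕ.NonZero (lucas p)
lucas-nonZero p = ℕ.>-nonZero (ℕ.≤-trans (fib-suc-pos p) (ℕ.m≤n+m (fib (suc p)) (fib (p ∸ 1))))
  where import Data.Nat.Properties as ℕ

fibOverLucas : ℕ → ℚ
fibOverLucas p = _/_ (+ fib p) (lucas p) {{lucas-nonZero p}}

oneOverFibSuc : ℕ → ℚ
oneOverFibSuc p = _/_ (+ 1) (fib (suc p)) {{fib-suc-nonZero p}}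

∑ : (n : ℕ) → (Fin n → ℚ) → ℚ
∑ zero f = 0ℚ
∑ (suc n) f = f Fin.zero + ∑ n (λ i → f (Fin.suc i))
  where import Data.Fin as Fin

Matrix : ℕ → Set
Matrix n = Fin n → Fin n → ℚ

_⊗_ : ∀ {n} → Matrix n → Matrix n → Matrix n
_⊗_ {n} A B i j = ∑ n (λ k → A i k * B k j)

transpose : ∀ {n} → Matrix n → Matrix n
transpose A i j = A j i

IsMoorePenroseInverse : ∀ {n} → Matrix n → Matrix n → Set
IsMoorePenroseInverse A X =
  (∀ i j → ((A ⊗ X) ⊗ A) i j ≡ A i j) ×
  (∀ i j → ((X ⊗ A) ⊗ X) i j ≡ X i j) ×
  (∀ i j → transpose (A ⊗ X) i j ≡ (A ⊗ X) i j) ×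
  (∀ i j → transpose (X ⊗ A) i j ≡ (X ⊗ A) i j)

-- Straight linear 2-tree on vertices {1,…,n}; Fin index i is vertex toℕ i + 1.
-- {a,b} is an edge iff 0 < |a - b| ≤ 2.
adjacent : ℕ → ℕ → Bool
adjacent a b = (0 <ᵇ ∣ a - b ∣) ∧ (∣ a - b ∣ ≤ᵇ 2)

adj : ∀ {n} → Matrix n
adj i j = if adjacent (toℕ i) (toℕ j) then 1ℚ else 0ℚ

laplacian : (n : ℕ) → Matrix n
laplacian n i j = if toℕ i ≡ᵇ toℕ j then ∑ n (λ k → adj i k) else - adj i j

e : ∀ {n} → ℕ → Fin n → ℚ
e a i = if suc (toℕ i) ≡ᵇ a then 1ℚ else 0ℚ

quadForm : ∀ {n} → Matrix n → ℕ → ℕ → ℚ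
quadForm {n} X a b =
  ∑ n (λ i → ∑ n (λ j → ((e a i - e b i) * X i j) * (e a j - e b j)))

resistance : (n : ℕ) → Matrix n → ℕ → ℕ → ℚ
resistance n X a b = quadForm X a b

-- Index the vertices 0, …, n−1. If L y = e_p − e_q then (e_p − e_q)ᵀ X (e_p − e_q) = y_p − y_q
-- for every X with L X L = L, so resistances are potential drops and only the first Penrose
-- equation is needed. By Cassini-type identities, s_k = (−1)^(k+1) F_k² is harmonic away from
-- the end of the half-infinite linear 2-tree; gluing s to its mirror image at the edge {a, a+1}
-- gives the potential of that edge, and its drop is F_{2a+1} F_{2b+1} / F_{2(a+b)+2} where
-- a + b = n − 2. For fixed a + b the product F_{2a+1} F_{2b+1} is least when a and b are as
-- equal as possible, where the drop equals F_{n−1}/L_{n−1} (+ 1/F_{2n−2} when n is odd). A pair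
-- at distance two has the sum of two edge potentials as potential and a larger drop, and a pair
-- at distance at least three has resistance at least ½ by Cauchy–Schwarz for the Dirichlet
-- energy against e_p − e_q, while the central value is at most ½.

module Submission where

open import Defs

module FibonacciProducts where

  open import Data.Nat
  open import Data.Nat.Properties
  open import Data.Nat.Tactic.RingSolver
  open import Data.List using (_∷_; [])
  open import Data.Sum using (_⊎_; inj₁; inj₂)
  open import Data.Empty using (⊥-elim)
  open import Relation.Binary.PropositionalEquality

  fib-add : ∀ m k → fib (suc (m + k)) ≡ fib (suc m) * fib (suc k) + fib m * fib k
  fib-add zero k = lem0 (fib (suc k))
    where
    lem0 : ∀ a → a ≡ 1 * a + 0
    lem0 = solve-∀
  fib-add (suc m) k = begin
      fib (suc (suc m + k))
        ≡⟨ cong (λ t → fib (suc t)) (sym (+-suc m k)) ⟩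
      fib (suc (m + suc k))
        ≡⟨ fib-add m (suc k) ⟩
      fib (suc m) * (fib (suc k) + fib k) + fib m * fib (suc k)
        ≡⟨ lem (fib (suc m)) (fib m) (fib (suc k)) (fib k) ⟩
      (fib (suc m) + fib m) * fib (suc k) + fib (suc m) * fib k ∎
    where
    open ≡-Reasoning
    lem : ∀ a b c d → a * (c + d) + b * c ≡ (a + b) * c + a * d
    lem = solve-∀

  fib-odd-sumSq : ∀ k → fib (suc k) * fib (suc k) + fib k * fib k ≡ fib (suc (k + k))
  fib-odd-sumSq k = sym (fib-add k k)

  fib-even-square : ∀ k → fib (suc (suc k)) * fib (suc (suc k)) ≡ fib k * fib k + fib (suc (suc (k + k)))
  fib-even-square k = begin
      (fib (suc k) + fib k) * (fib (suc k) + fib k)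
        ≡⟨ lem (fib (suc k)) (fib k) ⟩
      fib k * fib k + (fib (suc (suc k)) * fib (suc k) + fib (suc k) * fib k)
        ≡⟨ cong (fib k * fib k +_) (sym (fib-add (suc k) k)) ⟩
      fib k * fib k + fib (suc (suc k + k)) ∎
    where
    open ≡-Reasoning
    lem : ∀ a b → (a + b) * (a + b) ≡ b * b + ((a + b) * a + a * b)
    lem = solve-∀

  cassini-odd : ∀ a → fib (suc (a + a)) * fib (suc (a + a)) + fib (suc (a + a)) * fib (suc (suc (a + a)))
                 ≡ fib (suc (suc (a + a))) * fib (suc (suc (a + a))) + 1
  cassini-odd zero = refl
  cassini-odd (suc a) rewrite +-suc a a = begin
      (w + u) * (w + u) + (w + u) * ((w + u) + w)
        ≡⟨ lem1 u w ⟩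
      (u * u + u * w) + (u * u + 4 * u * w + 3 * w * w)
        ≡⟨ cong (_+ (u * u + 4 * u * w + 3 * w * w)) (cassini-odd a) ⟩
      (w * w + 1) + (u * u + 4 * u * w + 3 * w * w)
        ≡⟨ lem2 u w ⟩
      ((w + u) + w) * ((w + u) + w) + 1 ∎
    where
    open ≡-Reasoning
    u = fib (suc (a + a))
    w = fib (suc (suc (a + a)))
    lem1 : ∀ u w → (w + u) * (w + u) + (w + u) * ((w + u) + w) ≡ (u * u + u * w) + (u * u + 4 * u * w + 3 * w * w)
    lem1 = solve-∀
    lem2 : ∀ u w → (w * w + 1) + (u * u + 4 * u * w + 3 * w * w) ≡ ((w + u) + w) * ((w + u) + w) + 1
    lem2 = solve-∀

  cassini-even : ∀ h → fib (suc (h + h)) * fib (suc (suc (suc (h + h)))) ≡ fib (suc (suc (h + h))) * fib (suc (suc (h + h))) + 1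
  cassini-even h = begin
      u * (w + u)
        ≡⟨ lem u w ⟩
      u * u + u * w
        ≡⟨ cassini-odd h ⟩
      w * w + 1 ∎
    where
    open ≡-Reasoning
    u = fib (suc (h + h))
    w = fib (suc (suc (h + h)))
    lem : ∀ u w → u * (w + u) ≡ u * u + u * w
    lem = solve-∀

  oddFibProd : ℕ → ℕ → ℕ
  oddFibProd a b = fib (suc (a + a)) * fib (suc (b + b))

  oddFibProd-sym : ∀ a b → oddFibProd a b ≡ oddFibProd b a
  oddFibProd-sym a b = *-comm (fib (suc (a + a))) (fib (suc (b + b)))

  fib-suc-mono : ∀ k → fib (suc k) ≤ fib (suc (suc k))
  fib-suc-mono k = m≤m+n (fib (suc k)) (fib k)

  suc+suc : ∀ x → suc x + suc x ≡ suc (suc (x + x))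
  suc+suc x = cong suc (+-suc x x)

  oddFibProd-step : ∀ x e → oddFibProd (suc x) (suc (x + e)) ≤ oddFibProd x (suc (suc (x + e)))
  oddFibProd-step x e = subst₂ _≤_ (sym lhsEq) (sym rhsEq) (subst (LHS ≤_) (sym key) (m≤m+n LHS q))
    where
    u = fib (suc (x + x))
    w = fib (suc (suc (x + x)))
    p = fib (suc (e + e))
    q = fib (suc (suc (e + e)))
    LHS = (w + u) * (w * q + u * p)
    RHS = u * (w * ((q + p) + q) + u * (q + p))
    i1 : suc (x + e) + suc (x + e) ≡ suc (x + x) + suc (e + e)
    i1 = solve (x ∷ e ∷ [])
    i2 : suc (suc (x + e)) + suc (suc (x + e)) ≡ suc (x + x) + suc (suc (suc (e + e)))
    i2 = solve (x ∷ e ∷ [])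
    lhsEq : oddFibProd (suc x) (suc (x + e)) ≡ LHS
    lhsEq = cong₂ _*_ (cong (λ z → fib (suc z)) (suc+suc x)) (trans (cong (λ z → fib (suc z)) i1) (fib-add (suc (x + x)) (suc (e + e))))
    rhsEq : oddFibProd x (suc (suc (x + e))) ≡ RHS
    rhsEq = cong (u *_) (trans (cong (λ z → fib (suc z)) i2) (fib-add (suc (x + x)) (suc (suc (suc (e + e))))))
    key : RHS ≡ LHS + q
    key = begin
        RHS
          ≡⟨ l1 u w p q ⟩
        u * w * p + u * w * q + u * u * p + q * (u * u + u * w)
          ≡⟨ cong (λ z → u * w * p + u * w * q + u * u * p + q * z) (cassini-odd x) ⟩
        u * w * p + u * w * q + u * u * p + q * (w * w + 1)
          ≡⟨ l2 u w p q ⟩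
        LHS + q ∎
      where
      open ≡-Reasoning
      l1 : ∀ u w p q → u * (w * ((q + p) + q) + u * (q + p)) ≡ u * w * p + u * w * q + u * u * p + q * (u * u + u * w)
      l1 = solve-∀
      l2 : ∀ u w p q → u * w * p + u * w * q + u * u * p + q * (w * w + 1) ≡ (w + u) * (w * q + u * p) + q
      l2 = solve-∀

  oddFibProd-unbalance : ∀ t a e → oddFibProd (a + t) (a + t + e) ≤ oddFibProd a (a + (t + t) + e)
  oddFibProd-unbalance zero a e = ≤-reflexive (cong (λ z → oddFibProd z (a + 0 + e)) (+-identityʳ a))
  oddFibProd-unbalance (suc t) a e = begin
      oddFibProd (a + suc t) (a + suc t + e)
        ≡⟨ cong₂ oddFibProd (+-suc a t) (cong (_+ e) (+-suc a t)) ⟩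
      oddFibProd (suc a + t) (suc a + t + e)
        ≤⟨ oddFibProd-unbalance t (suc a) e ⟩
      oddFibProd (suc a) (suc a + (t + t) + e)
        ≡⟨ cong (λ z → oddFibProd (suc a) (suc z)) (+-assoc a (t + t) e) ⟩
      oddFibProd (suc a) (suc (a + ((t + t) + e)))
        ≤⟨ oddFibProd-step a ((t + t) + e) ⟩
      oddFibProd a (suc (suc (a + ((t + t) + e))))
        ≡⟨ cong (oddFibProd a) (i t a e) ⟩
      oddFibProd a (a + (suc t + suc t) + e) ∎
    where
    open ≤-Reasoning
    i : ∀ t a e → suc (suc (a + ((t + t) + e))) ≡ a + (suc t + suc t) + e
    i = solve-∀

  oddFibProd-half : ∀ c d → 2 * oddFibProd (suc c) (suc d) ≤ fib (suc (suc ((suc c + suc d) + (suc c + suc d))))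
  oddFibProd-half c d = subst₂ _≤_ (sym lhsEq) (sym rhsEq) (+-cancelʳ-≤ (A * C) _ _ (subst (_≤ RHS + A * C) (sym key) (+-monoʳ-≤ RHS xB≤AC)))
    where
    x = fib (suc (c + c))
    A = fib (suc (suc (c + c)))
    B = fib (suc (d + d))
    C = fib (suc (suc (d + d)))
    LHS = 2 * ((A + x) * (C + B))
    RHS = ((A + x) + A) * (C + B) + (A + x) * C
    xB≤AC : x * B ≤ A * C
    xB≤AC = *-mono-≤ (fib-suc-mono (c + c)) (fib-suc-mono (d + d))
    key : LHS + A * C ≡ RHS + x * B
    key = l x A B C
      where
      l : ∀ x A B C → 2 * ((A + x) * (C + B)) + A * C ≡ ((A + x) + A) * (C + B) + (A + x) * C + x * B
      l = solve-∀
    lhsEq : 2 * oddFibProd (suc c) (suc d) ≡ LHS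
    lhsEq = cong (2 *_) (cong₂ _*_ (cong (λ z → fib (suc z)) (suc+suc c)) (cong (λ z → fib (suc z)) (suc+suc d)))
    i3 : suc ((suc c + suc d) + (suc c + suc d)) ≡ suc (suc (suc (c + c))) + suc (suc (d + d))
    i3 = solve (c ∷ d ∷ [])
    rhsEq : fib (suc (suc ((suc c + suc d) + (suc c + suc d)))) ≡ RHS
    rhsEq = trans (cong (λ z → fib (suc z)) i3) (fib-add (suc (suc (suc (c + c)))) (suc (suc (d + d))))

  oddFibProd-dist2 : ∀ a b → oddFibProd a (suc b) ≤ fib (suc (a + a)) * fib (suc (suc (b + b))) + fib (suc (suc (a + a))) * fib (suc (b + b))
  oddFibProd-dist2 a b = subst (_≤ RHS) (sym lhsEq) (+-monoʳ-≤ (u * Q) (*-monoˡ-≤ P (fib-suc-mono (a + a))))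
    where
    u = fib (suc (a + a))
    Q = fib (suc (suc (b + b)))
    P = fib (suc (b + b))
    RHS = u * Q + fib (suc (suc (a + a))) * P
    lhsEq : oddFibProd a (suc b) ≡ u * Q + u * P
    lhsEq = trans (cong (λ z → u * fib (suc z)) (suc+suc b)) (*-distribˡ-+ u Q P)

  oddFibProd-min-≤ : ∀ c e a b → e ≤ 1 → a ≤ b → a + b ≡ c + (c + e) → oddFibProd c (c + e) ≤ oddFibProd a b
  oddFibProd-min-≤ c e a b e≤1 a≤b eq = subst₂ _≤_ (cong₂ oddFibProd (sym c≡) (cong (_+ e) (sym c≡)))
     (cong (oddFibProd a) (sym b≡)) (oddFibProd-unbalance t a e)
    where
    a≤c : a ≤ c
    a≤c with ≤-total a c
    ... | inj₁ p = p
    ... | inj₂ c≤a with m≤n⇒m<n∨m≡n c≤a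
    ...   | inj₂ refl = ≤-refl
    ...   | inj₁ c<a = ⊥-elim (<-irrefl refl (begin-strict
            c + (c + e)  ≤⟨ +-monoʳ-≤ c (+-monoʳ-≤ c e≤1) ⟩
            c + (c + 1)  <⟨ ≤-reflexive (l2 c) ⟩
            suc c + suc c ≤⟨ +-mono-≤ c<a c<a ⟩
            a + a        ≤⟨ +-monoʳ-≤ a a≤b ⟩
            a + b        ≡⟨ eq ⟩
            c + (c + e)  ∎))
      where
      open ≤-Reasoning
      l2 : ∀ c → suc (c + (c + 1)) ≡ suc c + suc c
      l2 = solve-∀
    t = c ∸ a
    c≡ : c ≡ a + t
    c≡ = sym (m+[n∸m]≡n a≤c)
    b≡ : b ≡ a + (t + t) + e
    b≡ = +-cancelˡ-≡ a b (a + (t + t) + e) (trans eq (trans (cong (λ z → z + (z + e)) c≡) (l a t e)))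
      where
      l : ∀ a t e → (a + t) + ((a + t) + e) ≡ a + (a + (t + t) + e)
      l = solve-∀

  oddFibProd-min′ : ∀ c e a b → e ≤ 1 → a + b ≡ c + (c + e) → oddFibProd c (c + e) ≤ oddFibProd a b
  oddFibProd-min′ c e a b e≤1 eq with ≤-total a b
  ... | inj₁ a≤b = oddFibProd-min-≤ c e a b e≤1 a≤b eq
  ... | inj₂ b≤a = subst (oddFibProd c (c + e) ≤_) (oddFibProd-sym b a) (oddFibProd-min-≤ c e b a e≤1 b≤a (trans (+-comm b a) eq))

  oddFibProd-min : ∀ c d a b → (d ≡ c ⊎ d ≡ suc c) → a + b ≡ c + d → oddFibProd c d ≤ oddFibProd a b
  oddFibProd-min c .c a b (inj₁ refl) eq = subst (λ z → oddFibProd c z ≤ oddFibProd a b) (+-identityʳ c) (oddFibProd-min′ c 0 a b z≤n (trans eq (cong (c +_) (sym (+-identityʳ c)))))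
  oddFibProd-min c .(suc c) a b (inj₂ refl) eq = subst (λ z → oddFibProd c z ≤ oddFibProd a b) (trans (+-suc c 0) (cong suc (+-identityʳ c)))
    (oddFibProd-min′ c 1 a b (s≤s z≤n) (trans eq (cong (c +_) (sym (trans (+-suc c 0) (cong suc (+-identityʳ c)))))))

module LinearTwoTree where

  open import Data.Nat as ℕ using (ℕ; zero; suc; _∸_; _≡ᵇ_; _<ᵇ_; _≤ᵇ_; ∣_-_∣; z≤n; s≤s; z<s; s<s)
  import Data.Nat.Properties as ℕP
  open import Data.Nat.Coprimality using (Coprime)
  open import Data.Nat.Divisibility using (∣1⇒≡1)
  open import Data.Nat.DivMod using (m≡m%n+[m/n]*n; m*n/n≡m)
  import Data.Nat.Tactic.RingSolver as NS
  import Data.Integer as ℤ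
  import Data.Integer.Properties as ℤP
  open import Data.Fin as Fin using (Fin; toℕ)
  import Data.Fin.Properties as FinP
  open import Data.Bool using (Bool; true; false; if_then_else_; _∧_; T)
  import Data.Rational
  open import Data.Rational using (ℚ; 0ℚ; 1ℚ; ½; _+_; _*_; -_; _-_; _/_; _≤_; _<_; mkℚ; toℚᵘ; NonNegative; Positive; positive; nonNegative; nonPositive)
  open import Data.Rational.Properties
  import Data.Rational.Unnormalised as ℚᵘ
  import Data.Rational.Unnormalised.Properties as ℚᵘP
  open import Data.Rational.Solver
  open +-*-Solver using (solve; _:+_; _:*_; _:-_; :-_; _:=_; con)
  open import Data.Product using (_×_; _,_; proj₁; proj₂; Σ-syntax)
  open import Data.Sum using (_⊎_; inj₁; inj₂)
  open import Data.Empty using (⊥-elim)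
  open import Relation.Nullary using (yes; no)
  open import Relation.Binary.Definitions using (tri<; tri≈; tri>)
  open import Relation.Binary.PropositionalEquality
  open import Function using (_∘_)
  open FibonacciProducts

  ∑ℕ : ℕ → (ℕ → ℚ) → ℚ
  ∑ℕ zero f = 0ℚ
  ∑ℕ (suc n) f = f 0 + ∑ℕ n (λ k → f (suc k))

  ∑-toℕ : ∀ n (f : ℕ → ℚ) → ∑ n (λ i → f (toℕ i)) ≡ ∑ℕ n f
  ∑-toℕ zero f = refl
  ∑-toℕ (suc n) f = cong (f 0 +_) (∑-toℕ n (λ k → f (suc k)))

  ∑-cong : ∀ n {f g : Fin n → ℚ} → (∀ i → f i ≡ g i) → ∑ n f ≡ ∑ n g
  ∑-cong zero eq = refl
  ∑-cong (suc n) eq = cong₂ _+_ (eq Fin.zero) (∑-cong n (λ i → eq (Fin.suc i)))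

  ∑-+ : ∀ n (f g : Fin n → ℚ) → ∑ n (λ i → f i + g i) ≡ ∑ n f + ∑ n g
  ∑-+ zero f g = refl
  ∑-+ (suc n) f g = begin
      (f Fin.zero + g Fin.zero) + ∑ n (λ i → f (Fin.suc i) + g (Fin.suc i))
        ≡⟨ cong ((f Fin.zero + g Fin.zero) +_) (∑-+ n _ _) ⟩
      (f Fin.zero + g Fin.zero) + (∑ n (λ i → f (Fin.suc i)) + ∑ n (λ i → g (Fin.suc i)))
        ≡⟨ solve 4 (λ a b c d → (a :+ b) :+ (c :+ d) := (a :+ c) :+ (b :+ d)) refl (f Fin.zero) (g Fin.zero) (∑ n (λ i → f (Fin.suc i))) (∑ n (λ i → g (Fin.suc i))) ⟩
      _ ∎
    where open ≡-Reasoning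

  ∑-distribˡ : ∀ n (c : ℚ) (f : Fin n → ℚ) → c * ∑ n f ≡ ∑ n (λ i → c * f i)
  ∑-distribˡ zero c f = *-zeroʳ c
  ∑-distribˡ (suc n) c f = trans (*-distribˡ-+ c _ _) (cong (c * f Fin.zero +_) (∑-distribˡ n c _))

  ∑-distribʳ : ∀ n (c : ℚ) (f : Fin n → ℚ) → ∑ n f * c ≡ ∑ n (λ i → f i * c)
  ∑-distribʳ n c f = trans (*-comm _ c) (trans (∑-distribˡ n c f) (∑-cong n (λ i → *-comm c (f i))))

  ∑-zero : ∀ n → ∑ n (λ _ → 0ℚ) ≡ 0ℚ
  ∑-zero zero = refl
  ∑-zero (suc n) = trans (+-identityˡ _) (∑-zero n)

  ∑-swap : ∀ n m (f : Fin n → Fin m → ℚ) → ∑ n (λ i → ∑ m (λ j → f i j)) ≡ ∑ m (λ j → ∑ n (λ i → f i j))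
  ∑-swap zero m f = sym (∑-zero m)
  ∑-swap (suc n) m f = begin
      ∑ m (λ j → f Fin.zero j) + ∑ n (λ i → ∑ m (λ j → f (Fin.suc i) j))
        ≡⟨ cong (∑ m (λ j → f Fin.zero j) +_) (∑-swap n m _) ⟩
      ∑ m (λ j → f Fin.zero j) + ∑ m (λ j → ∑ n (λ i → f (Fin.suc i) j))
        ≡⟨ sym (∑-+ m _ _) ⟩
      _ ∎
    where open ≡-Reasoning

  ∑ℕ-cong : ∀ n {f g : ℕ → ℚ} → (∀ k → k ℕ.< n → f k ≡ g k) → ∑ℕ n f ≡ ∑ℕ n g
  ∑ℕ-cong zero eq = refl
  ∑ℕ-cong (suc n) eq = cong₂ _+_ (eq 0 z<s) (∑ℕ-cong n (λ k k<n → eq (suc k) (s<s k<n)))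

  ∑ℕ-+ : ∀ n (f g : ℕ → ℚ) → ∑ℕ n (λ i → f i + g i) ≡ ∑ℕ n f + ∑ℕ n g
  ∑ℕ-+ zero f g = refl
  ∑ℕ-+ (suc n) f g = trans (cong ((f 0 + g 0) +_) (∑ℕ-+ n _ _))
    (solve 4 (λ a b c d → (a :+ b) :+ (c :+ d) := (a :+ c) :+ (b :+ d)) refl (f 0) (g 0) (∑ℕ n (λ k → f (suc k))) (∑ℕ n (λ k → g (suc k))))

  ∑ℕ-distribˡ : ∀ n (c : ℚ) (f : ℕ → ℚ) → c * ∑ℕ n f ≡ ∑ℕ n (λ i → c * f i)
  ∑ℕ-distribˡ zero c f = *-zeroʳ c
  ∑ℕ-distribˡ (suc n) c f = trans (*-distribˡ-+ c _ _) (cong (c * f 0 +_) (∑ℕ-distribˡ n c _))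

  ∑ℕ-zero : ∀ n {f : ℕ → ℚ} → (∀ k → f k ≡ 0ℚ) → ∑ℕ n f ≡ 0ℚ
  ∑ℕ-zero zero eq = refl
  ∑ℕ-zero (suc n) eq = trans (cong₂ _+_ (eq 0) (∑ℕ-zero n (λ k → eq (suc k)))) refl

  ∑ℕ-swap : ∀ n m (f : ℕ → ℕ → ℚ) → ∑ℕ n (λ i → ∑ℕ m (λ j → f i j)) ≡ ∑ℕ m (λ j → ∑ℕ n (λ i → f i j))
  ∑ℕ-swap zero m f = sym (∑ℕ-zero m (λ _ → refl))
  ∑ℕ-swap (suc n) m f = trans (cong (∑ℕ m (λ j → f 0 j) +_) (∑ℕ-swap n m _)) (sym (∑ℕ-+ m _ _))

  ∑ℕ-snoc : ∀ n (f : ℕ → ℚ) → ∑ℕ (suc n) f ≡ ∑ℕ n f + f n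
  ∑ℕ-snoc zero f = trans (+-identityʳ (f 0)) (sym (+-identityˡ (f 0)))
  ∑ℕ-snoc (suc n) f = trans (cong (f 0 +_) (∑ℕ-snoc n (λ k → f (suc k)))) (sym (+-assoc (f 0) (∑ℕ n (λ k → f (suc k))) (f (suc n))))

  ∑ℕ-reverse : ∀ n (f : ℕ → ℚ) → ∑ℕ n f ≡ ∑ℕ n (λ k → f (n ∸ suc k))
  ∑ℕ-reverse zero f = refl
  ∑ℕ-reverse (suc n) f = begin
      f 0 + ∑ℕ n (λ k → f (suc k))
        ≡⟨ cong (f 0 +_) (∑ℕ-reverse n (λ k → f (suc k))) ⟩
      f 0 + ∑ℕ n (λ k → f (suc (n ∸ suc k)))
        ≡⟨ cong (f 0 +_) (∑ℕ-cong n (λ k k<n → cong f (sym (ℕP.+-∸-assoc 1 k<n)))) ⟩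
      f 0 + ∑ℕ n (λ k → f (n ∸ k))
        ≡⟨ +-comm (f 0) (∑ℕ n (λ k → f (n ∸ k))) ⟩
      ∑ℕ n (λ k → f (n ∸ k)) + f 0
        ≡⟨ cong (λ x → ∑ℕ n (λ k → f (n ∸ k)) + f x) (sym (ℕP.n∸n≡0 n)) ⟩
      _ ≡⟨ sym (∑ℕ-snoc n (λ k → f (n ∸ k))) ⟩
      _ ∎
    where open ≡-Reasoning

  ≡ᵇ-true⇒≡ : ∀ i k → (i ≡ᵇ k) ≡ true → i ≡ k
  ≡ᵇ-true⇒≡ zero zero _ = refl
  ≡ᵇ-true⇒≡ (suc i) (suc k) eq = cong suc (≡ᵇ-true⇒≡ i k eq)

  ≡ᵇ-refl : ∀ i → (i ≡ᵇ i) ≡ true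
  ≡ᵇ-refl zero = refl
  ≡ᵇ-refl (suc i) = ≡ᵇ-refl i

  ≡ᵇ-sym : ∀ m n → (m ≡ᵇ n) ≡ (n ≡ᵇ m)
  ≡ᵇ-sym zero zero = refl
  ≡ᵇ-sym zero (suc n) = refl
  ≡ᵇ-sym (suc m) zero = refl
  ≡ᵇ-sym (suc m) (suc n) = ≡ᵇ-sym m n

  T⇒≡true : ∀ {b} → T b → b ≡ true
  T⇒≡true {true} _ = refl

  ≡true⇒T : ∀ {b} → b ≡ true → T b
  ≡true⇒T refl = _

  <ᵇ-true : ∀ {x y} → x ℕ.< y → (x <ᵇ y) ≡ true
  <ᵇ-true p = T⇒≡true (ℕP.<⇒<ᵇ p)

  ≤ᵇ-true : ∀ {x y} → x ℕ.≤ y → (x ≤ᵇ y) ≡ true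
  ≤ᵇ-true p = T⇒≡true (ℕP.≤⇒≤ᵇ p)

  ≤ᵇ-false : ∀ {x y} → y ℕ.< x → (x ≤ᵇ y) ≡ false
  ≤ᵇ-false {x} {y} p with x ≤ᵇ y in eq
  ... | false = refl
  ... | true = ⊥-elim (ℕP.<⇒≱ p (ℕP.≤ᵇ⇒≤ x y (≡true⇒T eq)))

  <ᵇ-false : ∀ {x y} → y ℕ.≤ x → (x <ᵇ y) ≡ false
  <ᵇ-false {x} {y} p with x <ᵇ y in eq
  ... | false = refl
  ... | true = ⊥-elim (ℕP.≤⇒≯ p (ℕP.<ᵇ⇒< x y (≡true⇒T eq)))

  -- eℕ a is e a read on indices: index k is the vertex labelled k + 1.
  eℕ : ℕ → ℕ → ℚ
  eℕ a k = if suc k ≡ᵇ a then 1ℚ else 0ℚ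

  ∑ℕ-*eℕ : ∀ n p (f : ℕ → ℚ) → p ℕ.< n → ∑ℕ n (λ i → f i * eℕ (suc p) i) ≡ f p
  ∑ℕ-*eℕ (suc n) zero f p<n = trans (cong₂ _+_ (*-identityʳ (f 0)) (∑ℕ-zero n (λ k → *-zeroʳ (f (suc k))))) (+-identityʳ _)
  ∑ℕ-*eℕ (suc n) (suc p) f (s<s p<n) = trans (cong (_+ ∑ℕ n (λ k → f (suc k) * eℕ (suc (suc p)) (suc k))) (*-zeroʳ (f 0)))
    (trans (+-identityˡ _) (∑ℕ-*eℕ n p (λ k → f (suc k)) p<n))

  eℕ-≢ : ∀ {i a} → i ≢ a → eℕ (suc a) i ≡ 0ℚ
  eℕ-≢ {i} {a} ne with i ≡ᵇ a in eq
  ... | false = refl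
  ... | true = ⊥-elim (ne (≡ᵇ-true⇒≡ i a eq))

  eℕ-same : ∀ a → eℕ (suc a) a ≡ 1ℚ
  eℕ-same a with a ≡ᵇ a in eq
  ... | true = refl
  ... | false = ⊥-elim (subst T (trans (sym (≡ᵇ-refl a)) eq) _)

  dipole : ℕ → ℕ → ℕ → ℚ
  dipole p q k = eℕ (suc p) k - eℕ (suc q) k

  dipole-≢ : ∀ {p q k} → k ≢ p → k ≢ q → dipole p q k ≡ 0ℚ
  dipole-≢ k≢p k≢q = cong₂ _-_ (eℕ-≢ k≢p) (eℕ-≢ k≢q)

  dipole-source : ∀ {p q} → p ≢ q → dipole p q p ≡ 1ℚ
  dipole-source {p} p≢q = cong₂ _-_ (eℕ-same p) (eℕ-≢ p≢q)

  dipole-sink : ∀ {p q} → p ≢ q → dipole p q q ≡ - 1ℚ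
  dipole-sink {q = q} p≢q = cong₂ _-_ (eℕ-≢ (p≢q ∘ sym)) (eℕ-same q)

  dipole-drop : ∀ {p q} → p ≢ q → dipole p q p - dipole p q q ≡ 1ℚ + 1ℚ
  dipole-drop p≢q = cong₂ _-_ (dipole-source p≢q) (dipole-sink p≢q)

  ∑ℕ-*-dipole : ∀ n (y : ℕ → ℚ) p q → p ℕ.< n → q ℕ.< n → ∑ℕ n (λ i → y i * dipole p q i) ≡ y p - y q
  ∑ℕ-*-dipole n y p q p<n q<n = begin
      ∑ℕ n (λ i → y i * (eℕ (suc p) i - eℕ (suc q) i))
        ≡⟨ ∑ℕ-cong n (λ i _ → solve 3 (λ y a b → y :* (a :- b) := y :* a :+ (:- y) :* b) refl (y i) (eℕ (suc p) i) (eℕ (suc q) i)) ⟩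
      ∑ℕ n (λ i → y i * eℕ (suc p) i + (- y i) * eℕ (suc q) i)
        ≡⟨ ∑ℕ-+ n _ _ ⟩
      ∑ℕ n (λ i → y i * eℕ (suc p) i) + ∑ℕ n (λ i → (- y i) * eℕ (suc q) i)
        ≡⟨ cong₂ _+_ (∑ℕ-*eℕ n p y p<n) (∑ℕ-*eℕ n q (λ i → - y i) q<n) ⟩
      y p + - y q ∎
    where open ≡-Reasoning

  ∑ℕ-dipole : ∀ n p q → p ℕ.< n → q ℕ.< n → ∑ℕ n (dipole p q) ≡ 0ℚ
  ∑ℕ-dipole n p q p<n q<n = trans (∑ℕ-cong n (λ i _ → sym (*-identityˡ (dipole p q i)))) (∑ℕ-*-dipole n (λ _ → 1ℚ) p q p<n q<n)

  -- Quadratic forms of generalised inverses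

  _▷_ : ∀ {n} → Matrix n → (Fin n → ℚ) → (Fin n → ℚ)
  _▷_ {n} M u i = ∑ n (λ k → M i k * u k)

  dot : ∀ {n} → (Fin n → ℚ) → (Fin n → ℚ) → ℚ
  dot {n} u w = ∑ n (λ i → u i * w i)

  dot-transpose : ∀ {n} (M : Matrix n) (y w : Fin n → ℚ) → dot (M ▷ y) w ≡ dot y (transpose M ▷ w)
  dot-transpose {n} M y w = begin
      ∑ n (λ i → ∑ n (λ k → M i k * y k) * w i)
        ≡⟨ ∑-cong n (λ i → ∑-distribʳ n (w i) (λ k → M i k * y k)) ⟩
      ∑ n (λ i → ∑ n (λ k → M i k * y k * w i))
        ≡⟨ ∑-swap n n _ ⟩
      ∑ n (λ k → ∑ n (λ i → M i k * y k * w i))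
        ≡⟨ ∑-cong n (λ k → ∑-cong n (λ i → solve 3 (λ m a b → m :* a :* b := a :* (m :* b)) refl (M i k) (y k) (w i))) ⟩
      ∑ n (λ k → ∑ n (λ i → y k * (M i k * w i)))
        ≡⟨ ∑-cong n (λ k → sym (∑-distribˡ n (y k) (λ i → M i k * w i))) ⟩
      ∑ n (λ k → y k * ∑ n (λ i → M i k * w i)) ∎
    where open ≡-Reasoning

  ▷-▷ : ∀ {n} (X L : Matrix n) (y : Fin n → ℚ) i → (X ▷ (L ▷ y)) i ≡ ((X ⊗ L) ▷ y) i
  ▷-▷ {n} X L y i = begin
      ∑ n (λ j → X i j * ∑ n (λ l → L j l * y l))
        ≡⟨ ∑-cong n (λ j → ∑-distribˡ n (X i j) (λ l → L j l * y l)) ⟩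
      ∑ n (λ j → ∑ n (λ l → X i j * (L j l * y l)))
        ≡⟨ ∑-swap n n _ ⟩
      ∑ n (λ l → ∑ n (λ j → X i j * (L j l * y l)))
        ≡⟨ ∑-cong n (λ l → ∑-cong n (λ j → sym (*-assoc (X i j) (L j l) (y l)))) ⟩
      ∑ n (λ l → ∑ n (λ j → X i j * L j l * y l))
        ≡⟨ ∑-cong n (λ l → sym (∑-distribʳ n (y l) (λ j → X i j * L j l))) ⟩
      ∑ n (λ l → ∑ n (λ j → X i j * L j l) * y l) ∎
    where open ≡-Reasoning

  ⊗-assoc : ∀ {n} (P Q R : Matrix n) i l → (P ⊗ (Q ⊗ R)) i l ≡ ((P ⊗ Q) ⊗ R) i l
  ⊗-assoc {n} P Q R i l = begin
      ∑ n (λ j → P i j * ∑ n (λ k → Q j k * R k l))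
        ≡⟨ ∑-cong n (λ j → ∑-distribˡ n (P i j) (λ k → Q j k * R k l)) ⟩
      ∑ n (λ j → ∑ n (λ k → P i j * (Q j k * R k l)))
        ≡⟨ ∑-swap n n _ ⟩
      ∑ n (λ k → ∑ n (λ j → P i j * (Q j k * R k l)))
        ≡⟨ ∑-cong n (λ k → ∑-cong n (λ j → sym (*-assoc (P i j) (Q j k) (R k l)))) ⟩
      ∑ n (λ k → ∑ n (λ j → P i j * Q j k * R k l))
        ≡⟨ ∑-cong n (λ k → sym (∑-distribʳ n (R k l) (λ j → P i j * Q j k))) ⟩
      ∑ n (λ k → ∑ n (λ j → P i j * Q j k) * R k l) ∎
    where open ≡-Reasoning

  ▷-congʳ : ∀ {n} (M : Matrix n) {u w : Fin n → ℚ} → (∀ i → u i ≡ w i) → ∀ i → (M ▷ u) i ≡ (M ▷ w) i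
  ▷-congʳ {n} M eq i = ∑-cong n (λ k → cong (M i k *_) (eq k))

  ▷-congˡ : ∀ {n} {M N : Matrix n} (u : Fin n → ℚ) → (∀ i j → M i j ≡ N i j) → ∀ i → (M ▷ u) i ≡ (N ▷ u) i
  ▷-congˡ {n} u eq i = ∑-cong n (λ k → cong (_* u k) (eq i k))

  IsGeneralisedInverse : ∀ {n} → Matrix n → Matrix n → Set
  IsGeneralisedInverse A X = ∀ i j → ((A ⊗ X) ⊗ A) i j ≡ A i j

  generalisedInverse-quadForm : ∀ {n} (L X : Matrix n) (y v : Fin n → ℚ) →
       (∀ i j → L i j ≡ L j i) →
       IsGeneralisedInverse L X →
       (∀ i → (L ▷ y) i ≡ v i) →
       dot v (X ▷ v) ≡ dot y v
  generalisedInverse-quadForm {n} L X y v L-sym LXL≡L Ly = begin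
      dot v (X ▷ v)
        ≡⟨ ∑-cong n (λ i → cong₂ _*_ (sym (Ly i)) (sym (▷-congʳ X Ly i))) ⟩
      dot (L ▷ y) (X ▷ (L ▷ y))
        ≡⟨ dot-transpose L y _ ⟩
      dot y (transpose L ▷ (X ▷ (L ▷ y)))
        ≡⟨ ∑-cong n (λ i → cong (y i *_) (▷-congʳ (transpose L) (▷-▷ X L y) i)) ⟩
      dot y (transpose L ▷ ((X ⊗ L) ▷ y))
        ≡⟨ ∑-cong n (λ i → cong (y i *_) (▷-▷ (transpose L) (X ⊗ L) y i)) ⟩
      dot y ((transpose L ⊗ (X ⊗ L)) ▷ y)
        ≡⟨ ∑-cong n (λ i → cong (y i *_) (▷-congˡ y (λ a b → ⊗-assoc (transpose L) X L a b) i)) ⟩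
      dot y (((transpose L ⊗ X) ⊗ L) ▷ y)
        ≡⟨ ∑-cong n (λ i → cong (y i *_) (▷-congˡ y (λ a b → ∑-cong n (λ k → cong (_* L k b) (∑-cong n (λ j → cong (_* X j k) (L-sym j a))))) i)) ⟩
      dot y (((L ⊗ X) ⊗ L) ▷ y)
        ≡⟨ ∑-cong n (λ i → cong (y i *_) (trans (▷-congˡ y LXL≡L i) (Ly i))) ⟩
      dot y v ∎
    where open ≡-Reasoning

  quadForm-dot : ∀ {n} (X : Matrix n) a b → quadForm X a b ≡ dot (λ i → e a i - e b i) (X ▷ (λ i → e a i - e b i))
  quadForm-dot {n} X a b = ∑-cong n (λ i → trans (∑-cong n (λ j → *-assoc (e a i - e b i) (X i j) (e a j - e b j)))
     (sym (∑-distribˡ n (e a i - e b i) (λ j → X i j * (e a j - e b j)))))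

  adjℚ : ℕ → ℕ → ℚ
  adjℚ i k = if adjacent i k then 1ℚ else 0ℚ

  adjℚ-sym : ∀ i k → adjℚ i k ≡ adjℚ k i
  adjℚ-sym i k = cong (λ d → if (0 <ᵇ d) ∧ (d ≤ᵇ 2) then 1ℚ else 0ℚ) (ℕP.∣-∣-comm i k)

  adjacent-irrefl : ∀ i → adjacent i i ≡ false
  adjacent-irrefl i = cong (λ d → (0 <ᵇ d) ∧ (d ≤ᵇ 2)) (ℕP.∣n-n∣≡0 i)

  adjℚ-irrefl : ∀ i → adjℚ i i ≡ 0ℚ
  adjℚ-irrefl i = cong (λ b → if b then 1ℚ else 0ℚ) (adjacent-irrefl i)

  lap : ℕ → (ℕ → ℚ) → ℕ → ℚ
  lap n u i = ∑ℕ n (λ k → adjℚ i k * (u i - u k))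

  ∑ℕ-δ : ∀ n i (c : ℚ) → i ℕ.< n → ∑ℕ n (λ k → if i ≡ᵇ k then c else 0ℚ) ≡ c
  ∑ℕ-δ (suc n) zero c _ = trans (cong (c +_) (∑ℕ-zero n (λ _ → refl))) (+-identityʳ c)
  ∑ℕ-δ (suc n) (suc i) c (s<s i<n) = trans (+-identityˡ _) (∑ℕ-δ n i c i<n)

  Potential : ℕ → ℕ → ℕ → (ℕ → ℚ) → Set
  Potential n p q y = ∀ i → i ℕ.< n → lap n y i ≡ dipole p q i

  laplacian-entry-* : ∀ n (i k : Fin n) (u : ℕ → ℚ) →
    laplacian n i k * u (toℕ k) ≡ (if toℕ i ≡ᵇ toℕ k then ∑ℕ n (λ m → adjℚ (toℕ i) m) * u (toℕ i) else 0ℚ) + - (adjℚ (toℕ i) (toℕ k) * u (toℕ k))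
  laplacian-entry-* n i k u with toℕ i ≡ᵇ toℕ k in eq
  ... | true rewrite ≡ᵇ-true⇒≡ (toℕ i) (toℕ k) eq | adjℚ-irrefl (toℕ k) =
     trans (cong (_* u (toℕ k)) (∑-toℕ n (adjℚ (toℕ k))))
       (solve 2 (λ d x → d :* x := d :* x :+ :- (con 0ℚ :* x)) refl (∑ℕ n (adjℚ (toℕ k))) (u (toℕ k)))
  ... | false = trans (sym (neg-distribˡ-* (adjℚ (toℕ i) (toℕ k)) (u (toℕ k)))) (sym (+-identityˡ _))

  laplacian-▷ : ∀ n (u : ℕ → ℚ) (i : Fin n) → (laplacian n ▷ (λ j → u (toℕ j))) i ≡ lap n u (toℕ i)
  laplacian-▷ n u i = begin
      ∑ n (λ k → laplacian n i k * u (toℕ k))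
        ≡⟨ ∑-cong n (λ k → laplacian-entry-* n i k u) ⟩
      ∑ n (λ k → (if toℕ i ≡ᵇ toℕ k then D * u (toℕ i) else 0ℚ) + - (adjℚ (toℕ i) (toℕ k) * u (toℕ k)))
        ≡⟨ ∑-toℕ n (λ k → (if toℕ i ≡ᵇ k then D * u (toℕ i) else 0ℚ) + - (adjℚ (toℕ i) k * u k)) ⟩
      ∑ℕ n (λ k → (if toℕ i ≡ᵇ k then D * u (toℕ i) else 0ℚ) + - (adjℚ (toℕ i) k * u k))
        ≡⟨ ∑ℕ-+ n _ _ ⟩
      ∑ℕ n (λ k → if toℕ i ≡ᵇ k then D * u (toℕ i) else 0ℚ) + ∑ℕ n (λ k → - (adjℚ (toℕ i) k * u k))
        ≡⟨ cong (_+ ∑ℕ n (λ k → - (adjℚ (toℕ i) k * u k))) (∑ℕ-δ n (toℕ i) _ (FinP.toℕ<n i)) ⟩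
      D * u (toℕ i) + ∑ℕ n (λ k → - (adjℚ (toℕ i) k * u k))
        ≡⟨ cong (_+ ∑ℕ n (λ k → - (adjℚ (toℕ i) k * u k))) (trans (*-comm D (u (toℕ i))) (∑ℕ-distribˡ n (u (toℕ i)) (adjℚ (toℕ i)))) ⟩
      ∑ℕ n (λ k → u (toℕ i) * adjℚ (toℕ i) k) + ∑ℕ n (λ k → - (adjℚ (toℕ i) k * u k))
        ≡⟨ sym (∑ℕ-+ n _ _) ⟩
      ∑ℕ n (λ k → u (toℕ i) * adjℚ (toℕ i) k + - (adjℚ (toℕ i) k * u k))
        ≡⟨ ∑ℕ-cong n (λ k _ → solve 3 (λ a x y → x :* a :+ :- (a :* y) := a :* (x :- y)) refl (adjℚ (toℕ i) k) (u (toℕ i)) (u k)) ⟩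
      lap n u (toℕ i) ∎
    where
    open ≡-Reasoning
    D = ∑ℕ n (λ m → adjℚ (toℕ i) m)

  laplacian-sym : ∀ n (i j : Fin n) → laplacian n i j ≡ laplacian n j i
  laplacian-sym n i j rewrite ≡ᵇ-sym (toℕ i) (toℕ j) with toℕ j ≡ᵇ toℕ i in eq
  ... | true rewrite FinP.toℕ-injective (≡ᵇ-true⇒≡ (toℕ j) (toℕ i) eq) = refl
  ... | false = cong -_ (adjℚ-sym (toℕ i) (toℕ j))

  when : Bool → ℚ → ℚ
  when b x = if b then x else 0ℚ

  leftNbrs : ℕ → (ℕ → ℚ) → ℚ
  leftNbrs zero g = 0ℚ
  leftNbrs (suc zero) g = g 0
  leftNbrs (suc (suc i)) g = g i + g (suc i)

  rightNbrs : ℕ → ℕ → (ℕ → ℚ) → ℚ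
  rightNbrs n i g = when (suc i <ᵇ n) (g (suc i)) + when (suc (suc i) <ᵇ n) (g (suc (suc i)))

  ∑ℕ-0* : ∀ n (g : ℕ → ℚ) → ∑ℕ n (λ k → 0ℚ * g k) ≡ 0ℚ
  ∑ℕ-0* n g = ∑ℕ-zero n (λ k → *-zeroˡ (g k))

  ∑ℕ-adjℚ-* : ∀ n i (g : ℕ → ℚ) → i ℕ.< n → ∑ℕ n (λ k → adjℚ i k * g k) ≡ leftNbrs i g + rightNbrs n i g
  ∑ℕ-adjℚ-* (suc n) (suc (suc (suc i))) g (s≤s p) =
    trans (cong (_+ ∑ℕ n (λ k → adjℚ (suc (suc i)) k * g (suc k))) (*-zeroˡ (g 0)))
      (trans (+-identityˡ _) (∑ℕ-adjℚ-* n (suc (suc i)) (λ k → g (suc k)) p))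
  ∑ℕ-adjℚ-* (suc zero) zero g _ = solve 1 (λ x → con 0ℚ :* x :+ con 0ℚ := con 0ℚ :+ (con 0ℚ :+ con 0ℚ)) refl (g 0)
  ∑ℕ-adjℚ-* (suc (suc zero)) zero g _ = solve 2 (λ x y → con 0ℚ :* x :+ (con 1ℚ :* y :+ con 0ℚ) := con 0ℚ :+ (y :+ con 0ℚ)) refl (g 0) (g 1)
  ∑ℕ-adjℚ-* (suc (suc (suc n))) zero g _ = trans
    (cong (λ t → 0ℚ * g 0 + (1ℚ * g 1 + (1ℚ * g 2 + t))) (∑ℕ-0* n (λ k → g (3 ℕ.+ k))))
    (solve 3 (λ x y z → con 0ℚ :* x :+ (con 1ℚ :* y :+ (con 1ℚ :* z :+ con 0ℚ)) := con 0ℚ :+ (y :+ z)) refl (g 0) (g 1) (g 2))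
  ∑ℕ-adjℚ-* (suc (suc zero)) (suc zero) g _ = solve 2 (λ x y → con 1ℚ :* x :+ (con 0ℚ :* y :+ con 0ℚ) := x :+ (con 0ℚ :+ con 0ℚ)) refl (g 0) (g 1)
  ∑ℕ-adjℚ-* (suc (suc (suc zero))) (suc zero) g _ = solve 3 (λ x y z → con 1ℚ :* x :+ (con 0ℚ :* y :+ (con 1ℚ :* z :+ con 0ℚ)) := x :+ (z :+ con 0ℚ)) refl (g 0) (g 1) (g 2)
  ∑ℕ-adjℚ-* (suc (suc (suc (suc n)))) (suc zero) g _ = trans
    (cong (λ t → 1ℚ * g 0 + (0ℚ * g 1 + (1ℚ * g 2 + (1ℚ * g 3 + t)))) (∑ℕ-0* n (λ k → g (4 ℕ.+ k))))
    (solve 4 (λ x y z w → con 1ℚ :* x :+ (con 0ℚ :* y :+ (con 1ℚ :* z :+ (con 1ℚ :* w :+ con 0ℚ))) := x :+ (z :+ w)) refl (g 0) (g 1) (g 2) (g 3))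
  ∑ℕ-adjℚ-* (suc (suc (suc zero))) (suc (suc zero)) g _ = solve 3 (λ x y z → con 1ℚ :* x :+ (con 1ℚ :* y :+ (con 0ℚ :* z :+ con 0ℚ)) := (x :+ y) :+ (con 0ℚ :+ con 0ℚ)) refl (g 0) (g 1) (g 2)
  ∑ℕ-adjℚ-* (suc (suc (suc (suc zero)))) (suc (suc zero)) g _ = solve 4 (λ x y z w → con 1ℚ :* x :+ (con 1ℚ :* y :+ (con 0ℚ :* z :+ (con 1ℚ :* w :+ con 0ℚ))) := (x :+ y) :+ (w :+ con 0ℚ)) refl (g 0) (g 1) (g 2) (g 3)
  ∑ℕ-adjℚ-* (suc (suc (suc (suc (suc n))))) (suc (suc zero)) g _ = trans
    (cong (λ t → 1ℚ * g 0 + (1ℚ * g 1 + (0ℚ * g 2 + (1ℚ * g 3 + (1ℚ * g 4 + t))))) (∑ℕ-0* n (λ k → g (5 ℕ.+ k))))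
    (solve 5 (λ x y z w v → con 1ℚ :* x :+ (con 1ℚ :* y :+ (con 0ℚ :* z :+ (con 1ℚ :* w :+ (con 1ℚ :* v :+ con 0ℚ)))) := (x :+ y) :+ (w :+ v)) refl (g 0) (g 1) (g 2) (g 3) (g 4))
  ∑ℕ-adjℚ-* (suc zero) (suc zero) g (s≤s ())
  ∑ℕ-adjℚ-* (suc zero) (suc (suc zero)) g (s≤s ())
  ∑ℕ-adjℚ-* (suc (suc zero)) (suc (suc zero)) g (s≤s (s≤s ()))

  ι : ℕ → ℚ
  ι x = ℤ.+ x / 1

  coprime-1 : ∀ x → Coprime x 1
  coprime-1 x p = ∣1⇒≡1 (proj₂ p)

  ι-mkℚ : ∀ x → ι x ≡ mkℚ (ℤ.+ x) 0 (coprime-1 x)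
  ι-mkℚ x = normalize-coprime (coprime-1 x)

  ι-+ : ∀ x y → ι (x ℕ.+ y) ≡ ι x + ι y
  ι-+ x y rewrite ι-mkℚ x | ι-mkℚ y = /-cong {ℤ.+ (x ℕ.+ y)} {1} {ℤ.+ x ℤ.* ℤ.+ 1 ℤ.+ ℤ.+ y ℤ.* ℤ.+ 1} {1}
     (trans (ℤP.pos-+ x y) (sym (cong₂ ℤ._+_ (ℤP.*-identityʳ (ℤ.+ x)) (ℤP.*-identityʳ (ℤ.+ y))))) refl

  ι-* : ∀ x y → ι (x ℕ.* y) ≡ ι x * ι y
  ι-* x y rewrite ι-mkℚ x | ι-mkℚ y = /-cong {ℤ.+ (x ℕ.* y)} {1} {ℤ.+ x ℤ.* ℤ.+ y} {1} (ℤP.pos-* x y) refl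

  ι-mono : ∀ {x y} → x ℕ.≤ y → ι x ≤ ι y
  ι-mono {x} {y} x≤y rewrite ι-mkℚ x | ι-mkℚ y = Data.Rational.*≤* (subst₂ ℤ._≤_ (sym (ℤP.*-identityʳ (ℤ.+ x))) (sym (ℤP.*-identityʳ (ℤ.+ y))) (ℤ.+≤+ x≤y))

  ι-sumSq : ∀ x y → ι (x ℕ.* x ℕ.+ y ℕ.* y) ≡ ι x * ι x + ι y * ι y
  ι-sumSq x y = trans (ι-+ (x ℕ.* x) (y ℕ.* y)) (cong₂ _+_ (ι-* x x) (ι-* y y))

  frac : ℕ → (d : ℕ) → .{{_ : ℕ.NonZero d}} → ℚ
  frac x d = ℤ.+ x / d

  toℚᵘ-frac : ∀ x d → toℚᵘ (frac x (suc d)) ℚᵘ.≃ ℚᵘ.mkℚᵘ (ℤ.+ x) d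
  toℚᵘ-frac x d = toℚᵘ-fromℚᵘ (ℚᵘ.mkℚᵘ (ℤ.+ x) d)

  toℚᵘ-ι : ∀ x → toℚᵘ (ι x) ℚᵘ.≃ ℚᵘ.mkℚᵘ (ℤ.+ x) 0
  toℚᵘ-ι x = toℚᵘ-frac x 0

  frac-suc-*-ι : ∀ x d → frac x (suc d) * ι (suc d) ≡ ι x
  frac-suc-*-ι x d = toℚᵘ-injective (ℚᵘP.≃-trans (toℚᵘ-homo-* (frac x (suc d)) (ι (suc d)))
     (ℚᵘP.≃-trans (ℚᵘP.*-cong (toℚᵘ-frac x d) (toℚᵘ-ι (suc d)))
       (ℚᵘP.≃-trans (ℚᵘ.*≡* eq) (ℚᵘP.≃-sym (toℚᵘ-ι x)))))
    where
    eq : (ℤ.+ x ℤ.* ℤ.+ suc d) ℤ.* ℤ.+ 1 ≡ ℤ.+ x ℤ.* ℤ.+ (suc d ℕ.* 1)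
    eq = trans (ℤP.*-identityʳ _) (cong (λ t → ℤ.+ x ℤ.* ℤ.+ t) (sym (ℕP.*-identityʳ (suc d))))

  frac-suc-split : ∀ x d → frac x (suc d) ≡ ι x * frac 1 (suc d)
  frac-suc-split x d = toℚᵘ-injective (ℚᵘP.≃-trans (toℚᵘ-frac x d)
     (ℚᵘP.≃-trans (ℚᵘ.*≡* eq) (ℚᵘP.≃-sym (ℚᵘP.≃-trans (toℚᵘ-homo-* (ι x) (frac 1 (suc d)))
        (ℚᵘP.*-cong (toℚᵘ-ι x) (toℚᵘ-frac 1 d))))))
    where
    eq : ℤ.+ x ℤ.* ℤ.+ (1 ℕ.* suc d) ≡ (ℤ.+ x ℤ.* ℤ.+ 1) ℤ.* ℤ.+ suc d
    eq = trans (cong (λ t → ℤ.+ x ℤ.* ℤ.+ t) (ℕP.*-identityˡ (suc d))) (cong (ℤ._* ℤ.+ suc d) (sym (ℤP.*-identityʳ (ℤ.+ x))))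

  frac-*-ι : ∀ x d .{{_ : ℕ.NonZero d}} → frac x d * ι d ≡ ι x
  frac-*-ι x (suc d) = frac-suc-*-ι x d

  frac-split : ∀ x d .{{_ : ℕ.NonZero d}} → frac x d ≡ ι x * frac 1 d
  frac-split x (suc d) = frac-suc-split x d

  -- The harmonic function (−1)^(k+1) F_k²

  sign : ℕ → ℚ
  sign zero = 1ℚ
  sign (suc zero) = - 1ℚ
  sign (suc (suc k)) = sign k

  sign-suc : ∀ k → sign (suc k) ≡ - sign k
  sign-suc zero = refl
  sign-suc (suc zero) = refl
  sign-suc (suc (suc k)) = sign-suc k

  sign-square : ∀ k → sign k * sign k ≡ 1ℚ
  sign-square zero = refl
  sign-square (suc zero) = refl
  sign-square (suc (suc k)) = sign-square k

  sign-prod-square : ∀ a b → (sign a * sign b) * (sign a * sign b) ≡ 1ℚ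
  sign-prod-square a b = trans (solve 2 (λ x y → (x :* y) :* (x :* y) := (x :* x) :* (y :* y)) refl (sign a) (sign b))
     (trans (cong₂ _*_ (sign-square a) (sign-square b)) refl)

  -- Kept opaque so that the normaliser never unfolds ι (fib k) into a normalised fraction.
  opaque
    fibℚ : ℕ → ℚ
    fibℚ k = ι (fib k)

  opaque
    unfolding fibℚ
    fibℚ-ι : ∀ k → fibℚ k ≡ ι (fib k)
    fibℚ-ι k = refl

  fibℚ-rec : ∀ k → fibℚ (suc (suc k)) ≡ fibℚ (suc k) + fibℚ k
  fibℚ-rec k = trans (fibℚ-ι (suc (suc k))) (trans (ι-+ (fib (suc k)) (fib k)) (sym (cong₂ _+_ (fibℚ-ι (suc k)) (fibℚ-ι k))))

  fibℚ-0 : fibℚ 0 ≡ 0ℚ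
  fibℚ-0 = fibℚ-ι 0

  fibℚ-1 : fibℚ 1 ≡ 1ℚ
  fibℚ-1 = fibℚ-ι 1

  fibℚ-2 : fibℚ 2 ≡ 1ℚ
  fibℚ-2 = trans (fibℚ-rec 0) (trans (cong₂ _+_ fibℚ-1 fibℚ-0) refl)

  fibℚ-3 : fibℚ 3 ≡ 1ℚ + 1ℚ
  fibℚ-3 = trans (fibℚ-rec 1) (cong₂ _+_ fibℚ-2 fibℚ-1)

  fibℚ-* : ∀ x y → fibℚ x * fibℚ y ≡ ι (fib x ℕ.* fib y)
  fibℚ-* x y = trans (cong₂ _*_ (fibℚ-ι x) (fibℚ-ι y)) (sym (ι-* (fib x) (fib y)))

  ι-sumProd : ∀ p q r u → ι (p ℕ.* q ℕ.+ r ℕ.* u) ≡ ι p * ι q + ι r * ι u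
  ι-sumProd p q r u = trans (ι-+ (p ℕ.* q) (r ℕ.* u)) (cong₂ _+_ (ι-* p q) (ι-* r u))

  altSq : ℕ → ℚ
  altSq k = sign (suc k) * (fibℚ k * fibℚ k)

  altSq-step : ∀ k → altSq (suc k) - altSq k ≡ sign k * fibℚ (suc (k ℕ.+ k))
  altSq-step k = begin
      sign k * (a * a) - sign (suc k) * (b * b)
        ≡⟨ cong (λ t → sign k * (a * a) - t * (b * b)) (sign-suc k) ⟩
      sign k * (a * a) - (- sign k) * (b * b)
        ≡⟨ solve 3 (λ e a b → e :* (a :* a) :- (:- e) :* (b :* b) := e :* (a :* a :+ b :* b)) refl (sign k) a b ⟩
      sign k * (a * a + b * b)
        ≡⟨ cong (sign k *_) (sym (trans (fibℚ-ι (suc (k ℕ.+ k))) (trans (cong ι (sym (fib-odd-sumSq k))) (trans (ι-sumSq (fib (suc k)) (fib k)) (sym (cong₂ (λ u v → u * u + v * v) (fibℚ-ι (suc k)) (fibℚ-ι k))))))) ⟩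
      sign k * fibℚ (suc (k ℕ.+ k)) ∎
    where
    open ≡-Reasoning
    a = fibℚ (suc k)
    b = fibℚ k

  altSq-step2 : ∀ k → altSq (suc (suc k)) - altSq k ≡ - (sign k * fibℚ (suc (suc (k ℕ.+ k))))
  altSq-step2 k = begin
      sign (suc k) * (c * c) - sign (suc k) * (b * b)
        ≡⟨ cong (λ t → t * (c * c) - t * (b * b)) (sign-suc k) ⟩
      (- sign k) * (c * c) - (- sign k) * (b * b)
        ≡⟨ cong (λ t → (- sign k) * t - (- sign k) * (b * b)) c² ⟩
      (- sign k) * (b * b + F2) - (- sign k) * (b * b)
        ≡⟨ solve 3 (λ e b f → (:- e) :* (b :* b :+ f) :- (:- e) :* (b :* b) := :- (e :* f)) refl (sign k) b F2 ⟩
      - (sign k * F2) ∎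
    where
    open ≡-Reasoning
    c = fibℚ (suc (suc k))
    b = fibℚ k
    F2 = fibℚ (suc (suc (k ℕ.+ k)))
    c² : c * c ≡ b * b + F2
    c² = trans (cong₂ _*_ (fibℚ-ι (suc (suc k))) (fibℚ-ι (suc (suc k)))) (trans (sym (ι-* (fib (suc (suc k))) (fib (suc (suc k)))))
          (trans (cong ι (fib-even-square k)) (trans (ι-+ (fib k ℕ.* fib k) _) (cong₂ _+_ (trans (ι-* (fib k) (fib k)) (sym (cong₂ _*_ (fibℚ-ι k) (fibℚ-ι k)))) (sym (fibℚ-ι _))))))

  defect : ℕ → ℚ
  defect i = leftNbrs i (λ k → altSq i - altSq k) + (altSq i - altSq (suc i)) + (altSq i - altSq (suc (suc i)))

  -- defect (2 + j) unfolds to this expression in altSq j, …, altSq (4 + j).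
  defect-expr : ℚ → ℚ → ℚ → ℚ → ℚ → ℚ
  defect-expr a b c d e = ((c - a) + (c - b)) + (c - d) + (c - e)

  defect-expr-identity : ∀ (ε x y : ℚ) →
    defect-expr ((- ε) * (x * x)) (ε * (y * y)) ((- ε) * ((y + x) * (y + x)))
         (ε * (((y + x) + y) * ((y + x) + y))) ((- ε) * ((((y + x) + y) + (y + x)) * (((y + x) + y) + (y + x)))) ≡ 0ℚ
  defect-expr-identity = solve 3 (λ ε x y →
     (((:- ε) :* ((y :+ x) :* (y :+ x)) :- (:- ε) :* (x :* x)) :+ ((:- ε) :* ((y :+ x) :* (y :+ x)) :- ε :* (y :* y)))
     :+ ((:- ε) :* ((y :+ x) :* (y :+ x)) :- ε :* (((y :+ x) :+ y) :* ((y :+ x) :+ y)))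
     :+ ((:- ε) :* ((y :+ x) :* (y :+ x)) :- (:- ε) :* ((((y :+ x) :+ y) :+ (y :+ x)) :* (((y :+ x) :+ y) :+ (y :+ x))))
     := con 0ℚ) refl

  defect-zero : ∀ i → defect i ≡ 0ℚ
  defect-zero zero = begin
      0ℚ + (sign 1 * (fibℚ 0 * fibℚ 0) - sign 2 * (fibℚ 1 * fibℚ 1)) + (sign 1 * (fibℚ 0 * fibℚ 0) - sign 3 * (fibℚ 2 * fibℚ 2))
        ≡⟨ cong₂ (λ u v → 0ℚ + (sign 1 * (u * u) - sign 2 * (v * v)) + (sign 1 * (u * u) - sign 3 * (fibℚ 2 * fibℚ 2))) fibℚ-0 fibℚ-1 ⟩
      0ℚ + (sign 1 * (0ℚ * 0ℚ) - sign 2 * (1ℚ * 1ℚ)) + (sign 1 * (0ℚ * 0ℚ) - sign 3 * (fibℚ 2 * fibℚ 2))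
        ≡⟨ cong (λ u → 0ℚ + (sign 1 * (0ℚ * 0ℚ) - sign 2 * (1ℚ * 1ℚ)) + (sign 1 * (0ℚ * 0ℚ) - sign 3 * (u * u))) fibℚ-2 ⟩
      _ ≡⟨ refl ⟩
      0ℚ ∎
    where open ≡-Reasoning
  defect-zero (suc zero) = begin
      (sign 2 * (fibℚ 1 * fibℚ 1) - sign 1 * (fibℚ 0 * fibℚ 0)) + (sign 2 * (fibℚ 1 * fibℚ 1) - sign 3 * (fibℚ 2 * fibℚ 2)) + (sign 2 * (fibℚ 1 * fibℚ 1) - sign 4 * (fibℚ 3 * fibℚ 3))
        ≡⟨ cong₂ (λ u v → (sign 2 * (u * u) - sign 1 * (v * v)) + (sign 2 * (u * u) - sign 3 * (fibℚ 2 * fibℚ 2)) + (sign 2 * (u * u) - sign 4 * (fibℚ 3 * fibℚ 3))) fibℚ-1 fibℚ-0 ⟩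
      (sign 2 * (1ℚ * 1ℚ) - sign 1 * (0ℚ * 0ℚ)) + (sign 2 * (1ℚ * 1ℚ) - sign 3 * (fibℚ 2 * fibℚ 2)) + (sign 2 * (1ℚ * 1ℚ) - sign 4 * (fibℚ 3 * fibℚ 3))
        ≡⟨ cong₂ (λ u v → (sign 2 * (1ℚ * 1ℚ) - sign 1 * (0ℚ * 0ℚ)) + (sign 2 * (1ℚ * 1ℚ) - sign 3 * (u * u)) + (sign 2 * (1ℚ * 1ℚ) - sign 4 * (v * v))) fibℚ-2 fibℚ-3 ⟩
      _ ≡⟨ refl ⟩
      0ℚ ∎
    where open ≡-Reasoning
  defect-zero (suc (suc j)) = begin
      defect-expr (altSq j) (altSq (suc j)) (altSq (suc (suc j))) (altSq (suc (suc (suc j)))) (altSq (suc (suc (suc (suc j)))))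
        ≡⟨ cong₂ (λ p q → defect-expr p (altSq (suc j)) q (altSq (suc (suc (suc j)))) (altSq (suc (suc (suc (suc j))))))
             (cong (_* (x * x)) (sign-suc j))
             (cong₂ _*_ (sign-suc j) (cong₂ _*_ f2 f2)) ⟩
      defect-expr ((- ε) * (x * x)) (altSq (suc j)) ((- ε) * ((y + x) * (y + x))) (altSq (suc (suc (suc j)))) (altSq (suc (suc (suc (suc j)))))
        ≡⟨ cong₂ (λ p q → defect-expr ((- ε) * (x * x)) (altSq (suc j)) ((- ε) * ((y + x) * (y + x))) p q)
             (cong (ε *_) (cong₂ _*_ f3 f3))
             (cong₂ _*_ (sign-suc j) (cong₂ _*_ f4 f4)) ⟩
      _ ≡⟨ defect-expr-identity ε x y ⟩
      0ℚ ∎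
    where
    open ≡-Reasoning
    ε = sign j
    x = fibℚ j
    y = fibℚ (suc j)
    f2 : fibℚ (suc (suc j)) ≡ y + x
    f2 = fibℚ-rec j
    f3 : fibℚ (suc (suc (suc j))) ≡ (y + x) + y
    f3 = trans (fibℚ-rec (suc j)) (cong (_+ y) f2)
    f4 : fibℚ (suc (suc (suc (suc j)))) ≡ ((y + x) + y) + (y + x)
    f4 = trans (fibℚ-rec (suc (suc j))) (cong₂ _+_ f3 f2)

  adjacent⇒near : ∀ i k → adjacent i k ≡ true → (k ℕ.≤ 2 ℕ.+ i) × (i ℕ.≤ 2 ℕ.+ k)
  adjacent⇒near zero zero ()
  adjacent⇒near zero (suc k) eq = ℕP.≤ᵇ⇒≤ (suc k) 2 (≡true⇒T eq) , z≤n
  adjacent⇒near (suc i) zero eq = z≤n , ℕP.≤ᵇ⇒≤ (suc i) 2 (≡true⇒T eq)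
  adjacent⇒near (suc i) (suc k) eq with adjacent⇒near i k eq
  ... | p , q = s≤s p , s≤s q

  lap-nbrs : ∀ n u i → i ℕ.< n → lap n u i ≡ leftNbrs i (λ k → u i - u k) + rightNbrs n i (λ k → u i - u k)
  lap-nbrs n u i p = ∑ℕ-adjℚ-* n i (λ k → u i - u k) p

  lap-local : ∀ n i (u w : ℕ → ℚ) → u i ≡ w i → (∀ k → adjacent i k ≡ true → u k ≡ w k) → lap n u i ≡ lap n w i
  lap-local n i u w ei ek = ∑ℕ-cong n λ k _ → pt k
    where
    pt : ∀ k → adjℚ i k * (u i - u k) ≡ adjℚ i k * (w i - w k)
    pt k with adjacent i k in eq
    ... | true = trans (cong (λ z → 1ℚ * (z - u k)) ei) (cong (λ z → 1ℚ * (w i - z)) (ek k eq))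
    ... | false = trans (*-zeroˡ (u i - u k)) (sym (*-zeroˡ (w i - w k)))

  lap-affine : ∀ n (u : ℕ → ℚ) (c d : ℚ) i → lap n (λ k → c * (u k - d)) i ≡ c * lap n u i
  lap-affine n u c d i = trans (∑ℕ-cong n (λ k _ → solve 5 (λ A x y c d → A :* (c :* (x :- d) :- c :* (y :- d)) := c :* (A :* (x :- y))) refl (adjℚ i k) (u i) (u k) c d))
     (sym (∑ℕ-distribˡ n c _))

  leftNbrs-cong : ∀ i {g h : ℕ → ℚ} → (∀ k → k ℕ.< i → g k ≡ h k) → leftNbrs i g ≡ leftNbrs i h
  leftNbrs-cong zero eq = refl
  leftNbrs-cong (suc zero) eq = eq 0 (s≤s z≤n)
  leftNbrs-cong (suc (suc i)) eq = cong₂ _+_ (eq i (s≤s (ℕP.n≤1+n i))) (eq (suc i) ℕP.≤-refl)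

  leftNbrs-scale : ∀ i (c : ℚ) (g : ℕ → ℚ) → leftNbrs i (λ k → c * g k) ≡ c * leftNbrs i g
  leftNbrs-scale zero c g = sym (*-zeroʳ c)
  leftNbrs-scale (suc zero) c g = refl
  leftNbrs-scale (suc (suc i)) c g = sym (*-distribˡ-+ c (g i) (g (suc i)))

  ∑ℕ-neg : ∀ n (f : ℕ → ℚ) → - ∑ℕ n f ≡ ∑ℕ n (λ i → - f i)
  ∑ℕ-neg zero f = refl
  ∑ℕ-neg (suc n) f = trans (neg-distrib-+ (f 0) _) (cong (- f 0 +_) (∑ℕ-neg n (λ k → f (suc k))))

  ∑ℕ-lap : ∀ n (u : ℕ → ℚ) → ∑ℕ n (lap n u) ≡ 0ℚ
  ∑ℕ-lap n u = begin
      S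
        ≡⟨ solve 1 (λ t → t := con ½ :* (t :+ t)) refl S ⟩
      ½ * (S + S)
        ≡⟨ cong (λ z → ½ * (S + z)) S≡-S ⟩
      ½ * (S + - S)
        ≡⟨ solve 1 (λ t → con ½ :* (t :+ :- t) := con 0ℚ) refl S ⟩
      0ℚ ∎
    where
    open ≡-Reasoning
    S = ∑ℕ n (lap n u)
    S≡-S : S ≡ - S
    S≡-S = begin
        ∑ℕ n (λ i → ∑ℕ n (λ k → adjℚ i k * (u i - u k)))
          ≡⟨ ∑ℕ-swap n n _ ⟩
        ∑ℕ n (λ k → ∑ℕ n (λ i → adjℚ i k * (u i - u k)))
          ≡⟨ ∑ℕ-cong n (λ k _ → ∑ℕ-cong n (λ i _ → trans (cong (_* (u i - u k)) (adjℚ-sym i k))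
                 (solve 3 (λ a x y → a :* (x :- y) := :- (a :* (y :- x))) refl (adjℚ k i) (u i) (u k)))) ⟩
        ∑ℕ n (λ k → ∑ℕ n (λ i → - (adjℚ k i * (u k - u i))))
          ≡⟨ ∑ℕ-cong n (λ k _ → sym (∑ℕ-neg n _)) ⟩
        ∑ℕ n (λ k → - ∑ℕ n (λ i → adjℚ k i * (u k - u i)))
          ≡⟨ sym (∑ℕ-neg n _) ⟩
        - S ∎

  ∑ℕ-single : ∀ n p (h : ℕ → ℚ) → p ℕ.< n → (∀ i → i ℕ.< n → i ≢ p → h i ≡ 0ℚ) → ∑ℕ n h ≡ h p
  ∑ℕ-single (suc n) zero h _ hz = trans (cong (h 0 +_) (trans (∑ℕ-cong n (λ k k<n → hz (suc k) (s≤s k<n) (λ ()))) (∑ℕ-zero n (λ _ → refl)))) (+-identityʳ _)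
  ∑ℕ-single (suc n) (suc p) h (s≤s p<n) hz = trans (cong (_+ ∑ℕ n (λ k → h (suc k))) (hz 0 z<s (λ ())))
    (trans (+-identityˡ _) (∑ℕ-single n p (λ k → h (suc k)) p<n (λ i i<n i≢p → hz (suc i) (s≤s i<n) (λ eq → i≢p (ℕP.suc-injective eq)))))

  altSq-harmonic : ∀ n i → suc (suc i) ℕ.< n → lap n altSq i ≡ 0ℚ
  altSq-harmonic n i p
    rewrite lap-nbrs n altSq i (ℕP.<-trans (ℕP.n<1+n i) (ℕP.<-trans (ℕP.n<1+n (suc i)) p))
          | <ᵇ-true (ℕP.<-trans (ℕP.n<1+n (suc i)) p) | <ᵇ-true p
    = trans (sym (+-assoc (leftNbrs i (λ k → altSq i - altSq k)) (altSq i - altSq (suc i)) (altSq i - altSq (suc (suc i))))) (defect-zero i)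

  ∣-∣-reflect : ∀ m i k → i ℕ.≤ m → k ℕ.≤ m → ∣ i - (m ∸ k) ∣ ≡ ∣ (m ∸ i) - k ∣
  ∣-∣-reflect m i k i≤m k≤m = begin
      ∣ i - (m ∸ k) ∣
        ≡⟨ sym (ℕP.∣m+n-m+o∣≡∣n-o∣ k i (m ∸ k)) ⟩
      ∣ k ℕ.+ i - k ℕ.+ (m ∸ k) ∣
        ≡⟨ cong₂ ∣_-_∣ (ℕP.+-comm k i) (ℕP.m+[n∸m]≡n k≤m) ⟩
      ∣ i ℕ.+ k - m ∣
        ≡⟨ ℕP.∣-∣-comm (i ℕ.+ k) m ⟩
      ∣ m - i ℕ.+ k ∣
        ≡⟨ cong (λ z → ∣ z - i ℕ.+ k ∣) (sym (ℕP.m+[n∸m]≡n i≤m)) ⟩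
      ∣ i ℕ.+ (m ∸ i) - i ℕ.+ k ∣
        ≡⟨ ℕP.∣m+n-m+o∣≡∣n-o∣ i (m ∸ i) k ⟩
      ∣ (m ∸ i) - k ∣ ∎
    where open ≡-Reasoning

  adjℚ-reflect : ∀ m i k → i ℕ.≤ m → k ℕ.≤ m → adjℚ i (m ∸ k) ≡ adjℚ (m ∸ i) k
  adjℚ-reflect m i k p q = cong (λ d → if (0 <ᵇ d) ∧ (d ≤ᵇ 2) then 1ℚ else 0ℚ) (∣-∣-reflect m i k p q)

  altSq-reflected-harmonic : ∀ m i → 2 ℕ.≤ i → i ℕ.≤ m → lap (suc m) (λ k → altSq (m ∸ k)) i ≡ 0ℚ
  altSq-reflected-harmonic m i 2≤i i≤m = begin
      ∑ℕ (suc m) (λ k → adjℚ i k * (altSq (m ∸ i) - altSq (m ∸ k)))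
        ≡⟨ ∑ℕ-reverse (suc m) (λ k → adjℚ i k * (altSq (m ∸ i) - altSq (m ∸ k))) ⟩
      ∑ℕ (suc m) (λ k → adjℚ i (m ∸ k) * (altSq (m ∸ i) - altSq (m ∸ (m ∸ k))))
        ≡⟨ ∑ℕ-cong (suc m) (λ k k<n → cong₂ (λ x y → x * (altSq (m ∸ i) - altSq y))
              (adjℚ-reflect m i k i≤m (ℕP.≤-pred k<n)) (ℕP.m∸[m∸n]≡n (ℕP.≤-pred k<n))) ⟩
      lap (suc m) altSq (m ∸ i)
        ≡⟨ altSq-harmonic (suc m) (m ∸ i) (s≤s bound) ⟩
      0ℚ ∎
    where
    open ≡-Reasoning
    bound : suc (suc (m ∸ i)) ℕ.≤ m
    bound = ℕP.≤-trans (ℕP.≤-trans (ℕP.≤-reflexive (ℕP.+-comm 2 (m ∸ i))) (ℕP.+-monoʳ-≤ (m ∸ i) 2≤i))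
              (ℕP.≤-reflexive (ℕP.m∸n+n≡m i≤m))

  -- Potentials of adjacent pairs and of pairs at distance two

  lap-scale : ∀ n (u : ℕ → ℚ) (c : ℚ) i → lap n (λ k → c * u k) i ≡ c * lap n u i
  lap-scale n u c i = trans (∑ℕ-cong n (λ k _ → solve 4 (λ A x y c → A :* (c :* x :- c :* y) := c :* (A :* (x :- y))) refl (adjℚ i k) (u i) (u k) c))
     (sym (∑ℕ-distribˡ n c _))

  lap-+ : ∀ n (u w : ℕ → ℚ) i → lap n (λ k → u k + w k) i ≡ lap n u i + lap n w i
  lap-+ n u w i = trans (∑ℕ-cong n (λ k _ → solve 5 (λ A x y x' y' → A :* ((x :+ x') :- (y :+ y')) := A :* (x :- y) :+ A :* (x' :- y')) refl (adjℚ i k) (u i) (u k) (w i) (w k)))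
     (∑ℕ-+ n _ _)

  oneOverFibSuc-*-fibℚ : ∀ p → oneOverFibSuc p * fibℚ (suc p) ≡ 1ℚ
  oneOverFibSuc-*-fibℚ p = trans (cong (oneOverFibSuc p *_) (fibℚ-ι (suc p))) (frac-*-ι 1 (fib (suc p)) {{fib-suc-nonZero p}})

  -- Y is altSq on [0, a+1] and its mirror image k ↦ altSq (n−1−k) on [a, n−1], each shifted to vanish at
  -- a+1 and scaled by the slope of the other so that both formulas agree on {a, a+1}; hence Y is
  -- harmonic except at a and a+1, where its Laplacian is ± jump.
  module Glued (a b : ℕ) where
    n : ℕ
    n = suc (suc (a ℕ.+ b))
    m : ℕ
    m = suc (a ℕ.+ b)
    mirror : ℕ → ℚ
    mirror k = altSq (m ∸ k)
    slopeL : ℚ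
    slopeL = altSq (suc b) - altSq b
    slopeR : ℚ
    slopeR = altSq a - altSq (suc a)
    Y : ℕ → ℚ
    Y k = if k ≤ᵇ suc a then slopeL * (altSq k - altSq (suc a)) else slopeR * (mirror k - mirror (suc a))

    mirror-a : mirror a ≡ altSq (suc b)
    mirror-a = cong altSq (trans (ℕP.+-∸-assoc 1 (ℕP.m≤m+n a b)) (cong suc (ℕP.m+n∸m≡n a b)))

    mirror-sa : mirror (suc a) ≡ altSq b
    mirror-sa = cong altSq (ℕP.m+n∸m≡n a b)

    Y-left : ∀ k → k ℕ.≤ suc a → Y k ≡ slopeL * (altSq k - altSq (suc a))
    Y-left k p rewrite ≤ᵇ-true p = refl

    Y-far : ∀ k → suc (suc a) ℕ.≤ k → Y k ≡ slopeR * (mirror k - mirror (suc a))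
    Y-far k p rewrite ≤ᵇ-false {k} {suc a} p = refl

    Y-right : ∀ k → a ℕ.≤ k → Y k ≡ slopeR * (mirror k - mirror (suc a))
    Y-right k p with ℕP.m≤n⇒m<n∨m≡n p
    ... | inj₂ refl = trans (Y-left a (ℕP.n≤1+n a)) (trans (*-comm slopeL slopeR) (cong (slopeR *_) (sym (cong₂ _-_ mirror-a mirror-sa))))
    ... | inj₁ a<k with ℕP.m≤n⇒m<n∨m≡n a<k
    ...   | inj₁ sa<k = Y-far k sa<k
    ...   | inj₂ refl = trans (Y-left (suc a) ℕP.≤-refl) (trans (solve 2 (λ p x → p :* (x :- x) := con 0ℚ) refl slopeL (altSq (suc a)))
                           (sym (solve 2 (λ q x → q :* (x :- x) := con 0ℚ) refl slopeR (mirror (suc a)))))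

    Y-sa : Y (suc a) ≡ 0ℚ
    Y-sa = trans (Y-left (suc a) ℕP.≤-refl) (solve 2 (λ p x → p :* (x :- x) := con 0ℚ) refl slopeL (altSq (suc a)))

    Y-a : Y a ≡ slopeL * slopeR
    Y-a = Y-left a (ℕP.n≤1+n a)

    sa<n : suc a ℕ.< n
    sa<n = s≤s (s≤s (ℕP.m≤m+n a b))

    a<n : a ℕ.< n
    a<n = ℕP.<-trans (ℕP.n<1+n a) sa<n

    lap-Y-left : ∀ i → suc i ℕ.≤ a → lap n Y i ≡ 0ℚ
    lap-Y-left i p = begin
        lap n Y i
          ≡⟨ lap-local n i Y (λ k → slopeL * (altSq k - altSq (suc a))) (Y-left i (ℕP.≤-trans (ℕP.n≤1+n i) (ℕP.≤-trans p (ℕP.n≤1+n a))))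
               (λ k adj → Y-left k (ℕP.≤-trans (proj₁ (adjacent⇒near i k adj)) (s≤s p))) ⟩
        lap n (λ k → slopeL * (altSq k - altSq (suc a))) i
          ≡⟨ lap-affine n altSq slopeL (altSq (suc a)) i ⟩
        slopeL * lap n altSq i
          ≡⟨ cong (slopeL *_) (altSq-harmonic n i (s≤s (s≤s (ℕP.≤-trans p (ℕP.m≤m+n a b))))) ⟩
        slopeL * 0ℚ
          ≡⟨ *-zeroʳ slopeL ⟩
        0ℚ ∎
      where open ≡-Reasoning

    lap-Y-right : ∀ i → suc (suc a) ℕ.≤ i → i ℕ.< n → lap n Y i ≡ 0ℚ
    lap-Y-right i p q = begin
        lap n Y i
          ≡⟨ lap-local n i Y (λ k → slopeR * (mirror k - mirror (suc a))) (Y-right i (ℕP.≤-trans (ℕP.n≤1+n a) (ℕP.≤-trans (ℕP.n≤1+n (suc a)) p)))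
               (λ k adj → Y-right k (ℕP.+-cancelˡ-≤ 2 a k (ℕP.≤-trans p (proj₂ (adjacent⇒near i k adj))))) ⟩
        lap n (λ k → slopeR * (mirror k - mirror (suc a))) i
          ≡⟨ lap-affine n mirror slopeR (mirror (suc a)) i ⟩
        slopeR * lap n mirror i
          ≡⟨ cong (slopeR *_) (altSq-reflected-harmonic m i (ℕP.≤-trans (s≤s (s≤s z≤n)) p) (ℕP.≤-pred q)) ⟩
        slopeR * 0ℚ
          ≡⟨ *-zeroʳ slopeR ⟩
        0ℚ ∎
      where open ≡-Reasoning

    b₂ : Bool
    b₂ = suc (suc a) <ᵇ n

    jumpR : ℚ
    jumpR = when b₂ (slopeR * (altSq (suc b) - mirror (suc (suc a))))

    jump : ℚ
    jump = slopeL * (altSq (suc (suc a)) - altSq a) + jumpR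

    lap-Y-a : lap n Y a ≡ jump
    lap-Y-a = begin
        lap n Y a
          ≡⟨ lap-nbrs n Y a a<n ⟩
        leftNbrs a (λ k → Y a - Y k) + (when (suc a <ᵇ n) (Y a - Y (suc a)) + when b₂ (Y a - Y (suc (suc a))))
          ≡⟨ cong (λ z → leftNbrs a (λ k → Y a - Y k) + (when z (Y a - Y (suc a)) + when b₂ (Y a - Y (suc (suc a)))))
               (<ᵇ-true sa<n) ⟩
        leftNbrs a (λ k → Y a - Y k) + ((Y a - Y (suc a)) + when b₂ (Y a - Y (suc (suc a))))
          ≡⟨ cong₂ (λ u v → u + ((Y a - Y (suc a)) + v)) lnb (cong (when b₂) r2) ⟩
        slopeL * L + ((Y a - Y (suc a)) + jumpR)
          ≡⟨ cong (λ z → slopeL * L + (z + jumpR)) (cong₂ _-_ Y-a Y-sa) ⟩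
        slopeL * L + ((slopeL * slopeR - 0ℚ) + jumpR)
          ≡⟨ cong (λ z → z + ((slopeL * slopeR - 0ℚ) + jumpR)) (cong (slopeL *_) Lval) ⟩
        slopeL * (0ℚ - (altSq a - altSq (suc a)) - (altSq a - altSq (suc (suc a)))) + ((slopeL * slopeR - 0ℚ) + jumpR)
          ≡⟨ solve 5 (λ p x y z d → p :* (con 0ℚ :- (x :- y) :- (x :- z)) :+ ((p :* (x :- y) :- con 0ℚ) :+ d) := p :* (z :- x) :+ d) refl slopeL (altSq a) (altSq (suc a)) (altSq (suc (suc a))) jumpR ⟩
        jump ∎
      where
      open ≡-Reasoning
      L = leftNbrs a (λ k → altSq a - altSq k)
      lnb : leftNbrs a (λ k → Y a - Y k) ≡ slopeL * L
      lnb = trans (leftNbrs-cong a (λ k k<a → trans (cong₂ _-_ Y-a (Y-left k (ℕP.≤-trans (ℕP.<⇒≤ k<a) (ℕP.n≤1+n a))))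
                (solve 4 (λ p x y z → p :* (x :- y) :- p :* (z :- y) := p :* (x :- z)) refl slopeL (altSq a) (altSq (suc a)) (altSq k))))
                (leftNbrs-scale a slopeL (λ k → altSq a - altSq k))
      r2 : Y a - Y (suc (suc a)) ≡ slopeR * (altSq (suc b) - mirror (suc (suc a)))
      r2 = trans (cong₂ _-_ Y-a (Y-right (suc (suc a)) (ℕP.≤-trans (ℕP.n≤1+n a) (ℕP.n≤1+n (suc a)))))
             (trans (cong (λ z → slopeL * slopeR - slopeR * (mirror (suc (suc a)) - z)) mirror-sa)
               (solve 5 (λ sb sb' q u b' → (sb :- b') :* q :- q :* (u :- b') := q :* (sb :- u)) refl (altSq (suc b)) (altSq b) slopeR (mirror (suc (suc a))) (altSq b)))
      Lval : L ≡ 0ℚ - (altSq a - altSq (suc a)) - (altSq a - altSq (suc (suc a)))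
      Lval = trans (solve 3 (λ l x y → l := (l :+ x :+ y) :- x :- y) refl L (altSq a - altSq (suc a)) (altSq a - altSq (suc (suc a))))
               (cong (λ z → z - (altSq a - altSq (suc a)) - (altSq a - altSq (suc (suc a)))) (defect-zero a))

    source : ℕ → ℚ
    source i = jump * dipole a (suc a) i

    a≢sa : a ≢ suc a
    a≢sa = ℕP.1+n≢n ∘ sym

    source-other : ∀ i → i ≢ a → i ≢ suc a → source i ≡ 0ℚ
    source-other i i≢a i≢sa = trans (cong (jump *_) (dipole-≢ i≢a i≢sa)) (*-zeroʳ jump)

    source-a : source a ≡ jump
    source-a = trans (cong (jump *_) (dipole-source a≢sa)) (*-identityʳ jump)

    source-sa : source (suc a) ≡ - jump
    source-sa = trans (cong (jump *_) (dipole-sink a≢sa)) (solve 1 (λ d → d :* (:- con 1ℚ) := :- d) refl jump)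

    lap-Y-≢ : ∀ i → i ℕ.< n → i ≢ suc a → lap n Y i ≡ source i
    lap-Y-≢ i i<n i≢sa with ℕP.<-cmp i a
    ... | tri< i<a _ _ = trans (lap-Y-left i i<a) (sym (source-other i (ℕP.<⇒≢ i<a) (λ e → ℕP.<⇒≢ (ℕP.<-trans i<a (ℕP.n<1+n a)) e)))
    ... | tri≈ _ refl _ = trans lap-Y-a (sym source-a)
    ... | tri> _ _ a<i = trans (lap-Y-right i ssa≤i i<n) (sym (source-other i (λ e → ℕP.<⇒≢ a<i (sym e)) i≢sa))
      where
      ssa≤i : suc (suc a) ℕ.≤ i
      ssa≤i with ℕP.m≤n⇒m<n∨m≡n a<i
      ... | inj₁ p = p
      ... | inj₂ e = ⊥-elim (i≢sa (sym e))

    lap-Y-sa : lap n Y (suc a) ≡ - jump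
    lap-Y-sa = begin
        lap n Y (suc a)
          ≡⟨ solve 2 (λ x t → x := (x :- t) :+ t) refl (lap n Y (suc a)) (source (suc a)) ⟩
        h (suc a) + source (suc a)
          ≡⟨ cong (_+ source (suc a)) (sym (∑ℕ-single n (suc a) h sa<n
               (λ i i<n i≢sa → trans (cong (_- source i) (lap-Y-≢ i i<n i≢sa)) (+-inverseʳ (source i))))) ⟩
        ∑ℕ n h + source (suc a)
          ≡⟨ cong (_+ source (suc a)) hsum ⟩
        0ℚ + source (suc a)
          ≡⟨ trans (+-identityˡ _) source-sa ⟩
        - jump ∎
      where
      open ≡-Reasoning
      h : ℕ → ℚ
      h i = lap n Y i - source i
      hsum : ∑ℕ n h ≡ 0ℚ
      hsum = begin
          ∑ℕ n (λ i → lap n Y i + - source i)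
            ≡⟨ ∑ℕ-+ n (lap n Y) (λ i → - source i) ⟩
          ∑ℕ n (lap n Y) + ∑ℕ n (λ i → - source i)
            ≡⟨ cong₂ _+_ (∑ℕ-lap n Y) (sym (∑ℕ-neg n source)) ⟩
          0ℚ + - ∑ℕ n source
            ≡⟨ cong (λ t → 0ℚ + - t) (trans (sym (∑ℕ-distribˡ n jump (dipole a (suc a)))) (cong (jump *_) (∑ℕ-dipole n a (suc a) a<n sa<n))) ⟩
          0ℚ + - (jump * 0ℚ)
            ≡⟨ solve 1 (λ d → con 0ℚ :+ :- (d :* con 0ℚ) := con 0ℚ) refl jump ⟩
          0ℚ ∎

    lap-Y : ∀ i → i ℕ.< n → lap n Y i ≡ source i
    lap-Y i i<n with i ℕ.≟ suc a
    ... | yes refl = trans lap-Y-sa (sym source-sa)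
    ... | no ne = lap-Y-≢ i i<n ne

    lap-scaled-Y : ∀ (c : ℚ) → c * jump ≡ 1ℚ → Potential n a (suc a) (λ k → c * Y k)
    lap-scaled-Y c c*jump≡1 i i<n = begin
        lap n (λ k → c * Y k) i
          ≡⟨ lap-scale n Y c i ⟩
        c * lap n Y i
          ≡⟨ cong (c *_) (lap-Y i i<n) ⟩
        c * (jump * dipole a (suc a) i)
          ≡⟨ sym (*-assoc c jump _) ⟩
        (c * jump) * dipole a (suc a) i
          ≡⟨ cong (_* dipole a (suc a) i) c*jump≡1 ⟩
        1ℚ * dipole a (suc a) i
          ≡⟨ *-identityˡ _ ⟩
        _ ∎
      where open ≡-Reasoning

  slopeL-closed : ∀ a b → Glued.slopeL a b ≡ sign b * fibℚ (suc (b ℕ.+ b))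
  slopeL-closed a b = altSq-step b

  slopeR-closed : ∀ a b → Glued.slopeR a b ≡ - (sign a * fibℚ (suc (a ℕ.+ a)))
  slopeR-closed a b = trans (solve 2 (λ x y → x :- y := :- (y :- x)) refl (altSq a) (altSq (suc a))) (cong -_ (altSq-step a))

  jumpR-closed : ∀ a b → Glued.jumpR a b ≡ Glued.slopeR a b * (sign b * fibℚ (b ℕ.+ b))
  jumpR-closed a zero = trans (cong (λ z → when z (Glued.slopeR a 0 * (altSq 1 - Glued.mirror a 0 (suc (suc a)))))
                         (<ᵇ-false (ℕP.≤-reflexive (cong (λ z → suc (suc z)) (ℕP.+-identityʳ a)))))
                  (trans (solve 1 (λ q → con 0ℚ := q :* (con 1ℚ :* con 0ℚ)) refl (Glued.slopeR a 0))
                    (cong (λ z → Glued.slopeR a 0 * (1ℚ * z)) (sym fibℚ-0)))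
  jumpR-closed a (suc b) = begin
      when (suc (suc a) <ᵇ suc (suc (a ℕ.+ suc b))) (slopeR * (altSq (suc (suc b)) - Glued.mirror a (suc b) (suc (suc a))))
        ≡⟨ cong (λ z → when z (slopeR * (altSq (suc (suc b)) - Glued.mirror a (suc b) (suc (suc a))))) (<ᵇ-true {a} {a ℕ.+ suc b} (ℕP.m<m+n a z<s)) ⟩
      slopeR * (altSq (suc (suc b)) - Glued.mirror a (suc b) (suc (suc a)))
        ≡⟨ cong (λ z → slopeR * (altSq (suc (suc b)) - altSq z)) mirror-index ⟩
      slopeR * (altSq (suc (suc b)) - altSq b)
        ≡⟨ cong (slopeR *_) (altSq-step2 b) ⟩
      slopeR * (- (sign b * fibℚ (suc (suc (b ℕ.+ b)))))
        ≡⟨ cong (λ v → slopeR * (- (sign b * fibℚ v))) (cong suc (sym (ℕP.+-suc b b))) ⟩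
      slopeR * (- (sign b * fibℚ (suc b ℕ.+ suc b)))
        ≡⟨ cong (slopeR *_) (solve 2 (λ e f → :- (e :* f) := (:- e) :* f) refl (sign b) (fibℚ (suc b ℕ.+ suc b))) ⟩
      slopeR * ((- sign b) * fibℚ (suc b ℕ.+ suc b))
        ≡⟨ cong (λ z → slopeR * (z * fibℚ (suc b ℕ.+ suc b))) (sym (sign-suc b)) ⟩
      slopeR * (sign (suc b) * fibℚ (suc b ℕ.+ suc b)) ∎
    where
    open ≡-Reasoning
    slopeR = Glued.slopeR a (suc b)
    mirror-index : (suc (a ℕ.+ suc b)) ∸ (suc (suc a)) ≡ b
    mirror-index = trans (cong (_∸ suc a) (ℕP.+-suc a b)) (ℕP.m+n∸m≡n a b)

  double-+ : ∀ a b → (a ℕ.+ a) ℕ.+ (b ℕ.+ b) ≡ (a ℕ.+ b) ℕ.+ (a ℕ.+ b)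
  double-+ = NS.solve-∀

  fibℚ-add : ∀ a b → fibℚ (suc (suc ((a ℕ.+ b) ℕ.+ (a ℕ.+ b)))) ≡ fibℚ (suc (suc (a ℕ.+ a))) * fibℚ (suc (b ℕ.+ b)) + fibℚ (suc (a ℕ.+ a)) * fibℚ (b ℕ.+ b)
  fibℚ-add a b = begin
      fibℚ (suc (suc ((a ℕ.+ b) ℕ.+ (a ℕ.+ b))))
        ≡⟨ cong (λ z → fibℚ (suc (suc z))) (sym (double-+ a b)) ⟩
      fibℚ (suc (suc ((a ℕ.+ a) ℕ.+ (b ℕ.+ b))))
        ≡⟨ fibℚ-ι _ ⟩
      ι (fib (suc (suc (a ℕ.+ a) ℕ.+ (b ℕ.+ b))))
        ≡⟨ cong ι (fib-add (suc (a ℕ.+ a)) (b ℕ.+ b)) ⟩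
      ι (fib (suc (suc (a ℕ.+ a))) ℕ.* fib (suc (b ℕ.+ b)) ℕ.+ fib (suc (a ℕ.+ a)) ℕ.* fib (b ℕ.+ b))
        ≡⟨ ι-sumProd (fib (suc (suc (a ℕ.+ a)))) (fib (suc (b ℕ.+ b))) (fib (suc (a ℕ.+ a))) (fib (b ℕ.+ b)) ⟩
      ι (fib (suc (suc (a ℕ.+ a)))) * ι (fib (suc (b ℕ.+ b))) + ι (fib (suc (a ℕ.+ a))) * ι (fib (b ℕ.+ b))
        ≡⟨ sym (cong₂ _+_ (cong₂ _*_ (fibℚ-ι _) (fibℚ-ι _)) (cong₂ _*_ (fibℚ-ι _) (fibℚ-ι _))) ⟩
      _ ∎
    where open ≡-Reasoning

  jump-closed : ∀ a b → Glued.jump a b ≡ - (sign a * sign b) * fibℚ (suc (suc ((a ℕ.+ b) ℕ.+ (a ℕ.+ b))))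
  jump-closed a b = begin
      Glued.slopeL a b * (altSq (suc (suc a)) - altSq a) + Glued.jumpR a b
        ≡⟨ cong₂ _+_ (cong₂ _*_ (slopeL-closed a b) (altSq-step2 a)) (trans (jumpR-closed a b) (cong (_* (sign b * fibℚ (b ℕ.+ b))) (slopeR-closed a b))) ⟩
      (sign b * fibℚ (suc (b ℕ.+ b))) * (- (sign a * fibℚ (suc (suc (a ℕ.+ a))))) + (- (sign a * fibℚ (suc (a ℕ.+ a)))) * (sign b * fibℚ (b ℕ.+ b))
        ≡⟨ solve 6 (λ ea eb x y z w → (eb :* y) :* (:- (ea :* x)) :+ (:- (ea :* z)) :* (eb :* w) := (:- (ea :* eb)) :* (x :* y :+ z :* w))
             refl (sign a) (sign b) (fibℚ (suc (suc (a ℕ.+ a)))) (fibℚ (suc (b ℕ.+ b))) (fibℚ (suc (a ℕ.+ a))) (fibℚ (b ℕ.+ b)) ⟩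
      (- (sign a * sign b)) * (fibℚ (suc (suc (a ℕ.+ a))) * fibℚ (suc (b ℕ.+ b)) + fibℚ (suc (a ℕ.+ a)) * fibℚ (b ℕ.+ b))
        ≡⟨ cong ((- (sign a * sign b)) *_) (sym (fibℚ-add a b)) ⟩
      _ ∎
    where open ≡-Reasoning

  fibIdx : ℕ → ℕ → ℕ
  fibIdx a b = suc ((a ℕ.+ b) ℕ.+ (a ℕ.+ b))

  invFib : ℕ → ℕ → ℚ
  invFib a b = oneOverFibSuc (fibIdx a b)

  invFib-nonneg : ∀ a b → NonNegative (invFib a b)
  invFib-nonneg a b = normalize-nonNeg 1 (fib (suc (fibIdx a b))) {{fib-suc-nonZero (fibIdx a b)}}

  scale : ℕ → ℕ → ℚ
  scale a b = - (sign a * sign b) * invFib a b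

  scale-*-jump : ∀ a b → scale a b * Glued.jump a b ≡ 1ℚ
  scale-*-jump a b = begin
      scale a b * Glued.jump a b
        ≡⟨ cong (scale a b *_) (jump-closed a b) ⟩
      (- ε * invFib a b) * (- ε * fibℚ (suc (fibIdx a b)))
        ≡⟨ solve 3 (λ e o f → (:- e :* o) :* (:- e :* f) := (e :* e) :* (o :* f)) refl ε (invFib a b) (fibℚ (suc (fibIdx a b))) ⟩
      (ε * ε) * (invFib a b * fibℚ (suc (fibIdx a b)))
        ≡⟨ cong₂ _*_ (sign-prod-square a b) (oneOverFibSuc-*-fibℚ (fibIdx a b)) ⟩
      1ℚ ∎
    where
    open ≡-Reasoning
    ε = sign a * sign b

  adjPotential : ℕ → ℕ → ℕ → ℚ
  adjPotential a b k = scale a b * Glued.Y a b k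

  lap-adjPotential : ∀ a b → Potential (suc (suc (a ℕ.+ b))) a (suc a) (adjPotential a b)
  lap-adjPotential a b = Glued.lap-scaled-Y a b (scale a b) (scale-*-jump a b)

  adjPotential-drop : ∀ a b → adjPotential a b a - adjPotential a b (suc a) ≡ (fibℚ (suc (a ℕ.+ a)) * fibℚ (suc (b ℕ.+ b))) * invFib a b
  adjPotential-drop a b = begin
      scale a b * Glued.Y a b a - scale a b * Glued.Y a b (suc a)
        ≡⟨ cong₂ (λ u v → scale a b * u - scale a b * v) (Glued.Y-a a b) (Glued.Y-sa a b) ⟩
      scale a b * (Glued.slopeL a b * Glued.slopeR a b) - scale a b * 0ℚ
        ≡⟨ cong₂ (λ u v → scale a b * (u * v) - scale a b * 0ℚ) (slopeL-closed a b) (slopeR-closed a b) ⟩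
      (- (sign a * sign b) * invFib a b) * ((sign b * fibℚ (suc (b ℕ.+ b))) * (- (sign a * fibℚ (suc (a ℕ.+ a))))) - (- (sign a * sign b) * invFib a b) * 0ℚ
        ≡⟨ solve 5 (λ ea eb o y x → (:- (ea :* eb) :* o) :* ((eb :* y) :* (:- (ea :* x))) :- (:- (ea :* eb) :* o) :* con 0ℚ := ((ea :* eb) :* (ea :* eb)) :* ((x :* y) :* o))
             refl (sign a) (sign b) (invFib a b) (fibℚ (suc (b ℕ.+ b))) (fibℚ (suc (a ℕ.+ a))) ⟩
      ((sign a * sign b) * (sign a * sign b)) * ((fibℚ (suc (a ℕ.+ a)) * fibℚ (suc (b ℕ.+ b))) * invFib a b)
        ≡⟨ trans (cong (_* ((fibℚ (suc (a ℕ.+ a)) * fibℚ (suc (b ℕ.+ b))) * invFib a b)) (sign-prod-square a b)) (*-identityˡ _) ⟩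
      _ ∎
    where open ≡-Reasoning

  dist2Potential : ℕ → ℕ → ℕ → ℚ
  dist2Potential a b k = adjPotential a (suc b) k + adjPotential (suc a) b k

  size-shift : ∀ a b → suc (suc (suc a ℕ.+ b)) ≡ suc (suc (a ℕ.+ suc b))
  size-shift a b = cong (λ z → suc (suc z)) (sym (ℕP.+-suc a b))

  lap-dist2Potential : ∀ a b → Potential (suc (suc (a ℕ.+ suc b))) a (suc (suc a)) (dist2Potential a b)
  lap-dist2Potential a b i i<n = begin
      lap n (dist2Potential a b) i
        ≡⟨ lap-+ n (adjPotential a (suc b)) (adjPotential (suc a) b) i ⟩
      lap n (adjPotential a (suc b)) i + lap n (adjPotential (suc a) b) i
        ≡⟨ cong₂ _+_ (lap-adjPotential a (suc b) i i<n)
             (trans (cong (λ z → lap z (adjPotential (suc a) b) i) (sym (size-shift a b))) (lap-adjPotential (suc a) b i (subst (i ℕ.<_) (sym (size-shift a b)) i<n))) ⟩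
      dipole a (suc a) i + dipole (suc a) (suc (suc a)) i
        ≡⟨ solve 3 (λ x y z → (x :- y) :+ (y :- z) := x :- z) refl (eℕ (suc a) i) (eℕ (suc (suc a)) i) (eℕ (suc (suc (suc a))) i) ⟩
      _ ∎
    where
    open ≡-Reasoning
    n = suc (suc (a ℕ.+ suc b))

  scale-shift : ∀ a b → scale (suc a) b ≡ scale a (suc b)
  scale-shift a b = begin
      - (sign (suc a) * sign b) * invFib (suc a) b
        ≡⟨ cong₂ (λ u v → - (u * sign b) * v) (sign-suc a) (cong oneOverFibSuc (cong suc (cong₂ ℕ._+_ (sym (ℕP.+-suc a b)) (sym (ℕP.+-suc a b))))) ⟩
      - ((- sign a) * sign b) * invFib a (suc b)
        ≡⟨ solve 3 (λ x y o → :- ((:- x) :* y) :* o := :- (x :* (:- y)) :* o) refl (sign a) (sign b) (invFib a (suc b)) ⟩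
      - (sign a * (- sign b)) * invFib a (suc b)
        ≡⟨ cong (λ u → - (sign a * u) * invFib a (suc b)) (sym (sign-suc b)) ⟩
      scale a (suc b) ∎
    where open ≡-Reasoning

  dist2Potential-drop : ∀ a b → dist2Potential a b a - dist2Potential a b (suc (suc a)) ≡
     (fibℚ (suc (a ℕ.+ a)) * fibℚ (suc (suc (b ℕ.+ b))) + fibℚ (suc (suc (a ℕ.+ a))) * fibℚ (suc (b ℕ.+ b))) * invFib a (suc b)
  dist2Potential-drop a b = begin
      (κ₁ * Y₁ a + κ₂ * Y₂ a) - (κ₁ * Y₁ (suc (suc a)) + κ₂ * Y₂ (suc (suc a)))
        ≡⟨ cong₂ (λ u v → (κ₁ * u + κ₂ * Y₂ a) - (κ₁ * v + κ₂ * Y₂ (suc (suc a)))) (Glued.Y-a a (suc b))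
             (trans (Glued.Y-far a (suc b) (suc (suc a)) ℕP.≤-refl) (cong₂ (λ u v → σR₁ * (altSq u - v)) mirror-index (Glued.mirror-sa a (suc b)))) ⟩
      (κ₁ * (σL₁ * σR₁) + κ₂ * Y₂ a) - (κ₁ * (σR₁ * (altSq b - altSq (suc b))) + κ₂ * Y₂ (suc (suc a)))
        ≡⟨ cong₂ (λ u v → (κ₁ * (σL₁ * σR₁) + κ₂ * u) - (κ₁ * (σR₁ * (altSq b - altSq (suc b))) + κ₂ * v))
             (Glued.Y-left (suc a) b a (ℕP.≤-trans (ℕP.n≤1+n a) (ℕP.n≤1+n (suc a)))) (Glued.Y-sa (suc a) b) ⟩
      (κ₁ * (σL₁ * σR₁) + κ₂ * (σL₂ * (altSq a - altSq (suc (suc a))))) - (κ₁ * (σR₁ * (altSq b - altSq (suc b))) + κ₂ * 0ℚ)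
        ≡⟨ solve 9 (λ κ₁ κ₂ q p x y z u w → (κ₁ :* ((x :- y) :* q) :+ κ₂ :* (p :* (u :- w))) :- (κ₁ :* (q :* (z :- y)) :+ κ₂ :* con 0ℚ)
                   := κ₁ :* (q :* (x :- z)) :+ κ₂ :* (p :* (u :- w))) refl κ₁ κ₂ σR₁ σL₂ (altSq (suc (suc b))) (altSq (suc b)) (altSq b) (altSq a) (altSq (suc (suc a))) ⟩
      κ₁ * (σR₁ * (altSq (suc (suc b)) - altSq b)) + κ₂ * (σL₂ * (altSq a - altSq (suc (suc a))))
        ≡⟨ cong₂ (λ u v → κ₁ * u + v) (cong₂ _*_ (slopeR-closed a (suc b)) (altSq-step2 b))
             (cong₂ _*_ (scale-shift a b) (cong₂ _*_ (altSq-step b) (trans (solve 2 (λ x y → x :- y := :- (y :- x)) refl (altSq a) (altSq (suc (suc a)))) (cong -_ (altSq-step2 a))))) ⟩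
      κ₁ * ((- (sign a * F1)) * (- (sign b * G2))) + κ₁ * ((sign b * G1) * (- (- (sign a * F2))))
        ≡⟨ cong (λ e → (- (sign a * e) * o) * ((- (sign a * F1)) * (- (sign b * G2))) + (- (sign a * e) * o) * ((sign b * G1) * (- (- (sign a * F2)))))
             (sign-suc b) ⟩
      (- (sign a * (- sign b)) * o) * ((- (sign a * F1)) * (- (sign b * G2))) + (- (sign a * (- sign b)) * o) * ((sign b * G1) * (- (- (sign a * F2))))
        ≡⟨ solve 7 (λ sa sb o f1 f2 g1 g2 →
              (:- (sa :* (:- sb)) :* o) :* ((:- (sa :* f1)) :* (:- (sb :* g2))) :+ (:- (sa :* (:- sb)) :* o) :* ((sb :* g1) :* (:- (:- (sa :* f2))))
              := ((sa :* sb) :* (sa :* sb)) :* ((f1 :* g2 :+ f2 :* g1) :* o)) refl (sign a) (sign b) o F1 F2 G1 G2 ⟩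
      ((sign a * sign b) * (sign a * sign b)) * ((F1 * G2 + F2 * G1) * o)
        ≡⟨ trans (cong (_* ((F1 * G2 + F2 * G1) * o)) (sign-prod-square a b)) (*-identityˡ _) ⟩
      (F1 * G2 + F2 * G1) * o ∎
    where
    open ≡-Reasoning
    κ₁ = scale a (suc b)
    κ₂ = scale (suc a) b
    Y₁ = Glued.Y a (suc b)
    Y₂ = Glued.Y (suc a) b
    σL₁ = Glued.slopeL a (suc b)
    σR₁ = Glued.slopeR a (suc b)
    σL₂ = Glued.slopeL (suc a) b
    o = invFib a (suc b)
    F1 = fibℚ (suc (a ℕ.+ a))
    F2 = fibℚ (suc (suc (a ℕ.+ a)))
    G1 = fibℚ (suc (b ℕ.+ b))
    G2 = fibℚ (suc (suc (b ℕ.+ b)))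
    mirror-index : (suc (a ℕ.+ suc b)) ∸ (suc (suc a)) ≡ b
    mirror-index = trans (cong (_∸ suc a) (ℕP.+-suc a b)) (ℕP.m+n∸m≡n a b)

  -- Dirichlet energy

  energy : ℕ → (ℕ → ℚ) → (ℕ → ℚ) → ℚ
  energy n z y = ∑ℕ n (λ i → z i * lap n y i)

  edgeEnergy : ℕ → (ℕ → ℚ) → (ℕ → ℚ) → ℚ
  edgeEnergy n z y = ∑ℕ n (λ i → ∑ℕ n (λ k → adjℚ i k * ((z i - z k) * (y i - y k))))

  energy-double : ∀ n z y → energy n z y + energy n z y ≡ edgeEnergy n z y
  energy-double n z y = begin
      energy n z y + energy n z y
        ≡⟨ cong₂ _+_ energy≡M energy≡M ⟩
      M + M
        ≡⟨ cong (M +_) (∑ℕ-swap n n f) ⟩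
      M + ∑ℕ n (λ i → ∑ℕ n (λ k → f k i))
        ≡⟨ sym (∑ℕ-+ n _ _) ⟩
      ∑ℕ n (λ i → ∑ℕ n (λ k → f i k) + ∑ℕ n (λ k → f k i))
        ≡⟨ ∑ℕ-cong n (λ i _ → sym (∑ℕ-+ n _ _)) ⟩
      ∑ℕ n (λ i → ∑ℕ n (λ k → f i k + f k i))
        ≡⟨ ∑ℕ-cong n (λ i _ → ∑ℕ-cong n (λ k _ → trans (cong (λ w → f i k + z k * (w * (y k - y i))) (adjℚ-sym k i))
             (solve 5 (λ A zi zk yi yk → zi :* (A :* (yi :- yk)) :+ zk :* (A :* (yk :- yi)) := A :* ((zi :- zk) :* (yi :- yk))) refl (adjℚ i k) (z i) (z k) (y i) (y k)))) ⟩
      edgeEnergy n z y ∎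
    where
    open ≡-Reasoning
    f : ℕ → ℕ → ℚ
    f i k = z i * (adjℚ i k * (y i - y k))
    M = ∑ℕ n (λ i → ∑ℕ n (λ k → f i k))
    energy≡M : energy n z y ≡ M
    energy≡M = ∑ℕ-cong n (λ i _ → ∑ℕ-distribˡ n (z i) (λ k → adjℚ i k * (y i - y k)))

  energy-sym : ∀ n z y → energy n z y ≡ energy n y z
  energy-sym n z y = begin
      energy n z y
        ≡⟨ solve 1 (λ x → x := con ½ :* (x :+ x)) refl (energy n z y) ⟩
      ½ * (energy n z y + energy n z y)
        ≡⟨ cong (½ *_) (trans (energy-double n z y) (trans (∑ℕ-cong n (λ i _ → ∑ℕ-cong n (λ k _ → cong (adjℚ i k *_) (*-comm (z i - z k) (y i - y k))))) (sym (energy-double n y z)))) ⟩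
      ½ * (energy n y z + energy n y z)
        ≡⟨ solve 1 (λ x → con ½ :* (x :+ x) := x) refl (energy n y z) ⟩
      energy n y z ∎
    where open ≡-Reasoning

  sq-nonneg : ∀ x → 0ℚ ≤ x * x
  sq-nonneg x with ≤-total 0ℚ x
  ... | inj₁ p = nonNegative⁻¹ _ {{nonNeg*nonNeg⇒nonNeg x {{nonNegative p}} x {{nonNegative p}}}}
  ... | inj₂ p = nonNegative⁻¹ _ {{nonPos*nonPos⇒nonPos x {{nonPositive p}} x {{nonPositive p}}}}

  ∑ℕ-nonneg : ∀ n (f : ℕ → ℚ) → (∀ k → 0ℚ ≤ f k) → 0ℚ ≤ ∑ℕ n f
  ∑ℕ-nonneg zero f h = ≤-refl
  ∑ℕ-nonneg (suc n) f h = subst (_≤ (f 0 + ∑ℕ n (λ k → f (suc k)))) (+-identityʳ 0ℚ) (+-mono-≤ (h 0) (∑ℕ-nonneg n _ (λ k → h (suc k))))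

  adjℚ-*-square-nonneg : ∀ i k x → 0ℚ ≤ adjℚ i k * (x * x)
  adjℚ-*-square-nonneg i k x with adjacent i k
  ... | true = subst (0ℚ ≤_) (sym (*-identityˡ (x * x))) (sq-nonneg x)
  ... | false = subst (0ℚ ≤_) (sym (*-zeroˡ (x * x))) ≤-refl

  energy-nonneg : ∀ n u → 0ℚ ≤ energy n u u
  energy-nonneg n u = subst (0ℚ ≤_) (sym half) (subst (_≤ ½ * edgeEnergy n u u) (*-zeroʳ ½) (*-monoˡ-≤-nonNeg ½ edges≥0))
    where
    half : energy n u u ≡ ½ * edgeEnergy n u u
    half = trans (solve 1 (λ x → x := con ½ :* (x :+ x)) refl (energy n u u)) (cong (½ *_) (energy-double n u u))
    edges≥0 : 0ℚ ≤ edgeEnergy n u u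
    edges≥0 = ∑ℕ-nonneg n _ (λ i → ∑ℕ-nonneg n _ (λ k → adjℚ-*-square-nonneg i k (u i - u k)))

  ∑ℕ-linear₄ : ∀ n (a b c d : ℚ) (f g h w : ℕ → ℚ) →
    ∑ℕ n (λ i → a * f i + b * g i + c * h i + d * w i) ≡ a * ∑ℕ n f + b * ∑ℕ n g + c * ∑ℕ n h + d * ∑ℕ n w
  ∑ℕ-linear₄ n a b c d f g h w = begin
      ∑ℕ n (λ i → a * f i + b * g i + c * h i + d * w i)
        ≡⟨ ∑ℕ-+ n (λ i → a * f i + b * g i + c * h i) (λ i → d * w i) ⟩
      ∑ℕ n (λ i → a * f i + b * g i + c * h i) + ∑ℕ n (λ i → d * w i)
        ≡⟨ cong₂ _+_ (trans (∑ℕ-+ n (λ i → a * f i + b * g i) (λ i → c * h i)) (cong₂ _+_ (∑ℕ-+ n (λ i → a * f i) (λ i → b * g i)) refl)) (sym (∑ℕ-distribˡ n d w)) ⟩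
      ∑ℕ n (λ i → a * f i) + ∑ℕ n (λ i → b * g i) + ∑ℕ n (λ i → c * h i) + d * ∑ℕ n w
        ≡⟨ cong₂ (λ u v → u + v + ∑ℕ n (λ i → c * h i) + d * ∑ℕ n w) (sym (∑ℕ-distribˡ n a f)) (sym (∑ℕ-distribˡ n b g)) ⟩
      a * ∑ℕ n f + b * ∑ℕ n g + ∑ℕ n (λ i → c * h i) + d * ∑ℕ n w
        ≡⟨ cong (λ u → a * ∑ℕ n f + b * ∑ℕ n g + u + d * ∑ℕ n w) (sym (∑ℕ-distribˡ n c h)) ⟩
      a * ∑ℕ n f + b * ∑ℕ n g + c * ∑ℕ n h + d * ∑ℕ n w ∎
    where
    open ≡-Reasoning

  lap-linear : ∀ n (y z : ℕ → ℚ) (α β : ℚ) i → lap n (λ k → α * y k - β * z k) i ≡ α * lap n y i - β * lap n z i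
  lap-linear n y z α β i = begin
      lap n (λ k → α * y k - β * z k) i
        ≡⟨ ∑ℕ-cong n (λ k _ → solve 7 (λ A a b yi yk zi zk → A :* ((a :* yi :- b :* zi) :- (a :* yk :- b :* zk)) := a :* (A :* (yi :- yk)) :+ (:- b) :* (A :* (zi :- zk)))
             refl (adjℚ i k) α β (y i) (y k) (z i) (z k)) ⟩
      ∑ℕ n (λ k → α * (adjℚ i k * (y i - y k)) + (- β) * (adjℚ i k * (z i - z k)))
        ≡⟨ ∑ℕ-+ n _ _ ⟩
      ∑ℕ n (λ k → α * (adjℚ i k * (y i - y k))) + ∑ℕ n (λ k → (- β) * (adjℚ i k * (z i - z k)))
        ≡⟨ cong₂ _+_ (sym (∑ℕ-distribˡ n α _)) (sym (∑ℕ-distribˡ n (- β) _)) ⟩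
      α * lap n y i + (- β) * lap n z i
        ≡⟨ solve 4 (λ a b x w → a :* x :+ (:- b) :* w := a :* x :- b :* w) refl α β (lap n y i) (lap n z i) ⟩
      α * lap n y i - β * lap n z i ∎
    where open ≡-Reasoning

  energy-cauchySchwarz : ∀ n (y z : ℕ → ℚ) → 0ℚ < energy n z z → energy n z y * energy n z y ≤ energy n z z * energy n y y
  energy-cauchySchwarz n y z Ez>0 =
    subst₂ _≤_ (+-identityʳ (B * B)) (solve 2 (λ b x → b :* b :+ (x :- b :* b) := x) refl B (Ez * Ey)) (+-monoʳ-≤ (B * B) gap≥0)
    where
    open ≡-Reasoning
    Ez = energy n z z
    B = energy n z y
    Ey = energy n y y
    u : ℕ → ℚ
    u k = Ez * y k - B * z k
    expand : energy n u u ≡ Ez * (Ez * Ey - B * B)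
    expand = begin
        ∑ℕ n (λ i → u i * lap n u i)
          ≡⟨ ∑ℕ-cong n (λ i _ → cong (u i *_) (lap-linear n y z Ez B i)) ⟩
        ∑ℕ n (λ i → u i * (Ez * lap n y i - B * lap n z i))
          ≡⟨ ∑ℕ-cong n (λ i _ → solve 6 (λ e b yi zi ly lz → (e :* yi :- b :* zi) :* (e :* ly :- b :* lz)
                 := (e :* e) :* (yi :* ly) :+ (:- (e :* b)) :* (yi :* lz) :+ (:- (b :* e)) :* (zi :* ly) :+ (b :* b) :* (zi :* lz))
                 refl Ez B (y i) (z i) (lap n y i) (lap n z i)) ⟩
        ∑ℕ n (λ i → (Ez * Ez) * (y i * lap n y i) + (- (Ez * B)) * (y i * lap n z i) + (- (B * Ez)) * (z i * lap n y i) + (B * B) * (z i * lap n z i))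
          ≡⟨ ∑ℕ-linear₄ n (Ez * Ez) (- (Ez * B)) (- (B * Ez)) (B * B) (λ i → y i * lap n y i) (λ i → y i * lap n z i) (λ i → z i * lap n y i) (λ i → z i * lap n z i) ⟩
        (Ez * Ez) * Ey + (- (Ez * B)) * energy n y z + (- (B * Ez)) * B + (B * B) * Ez
          ≡⟨ cong (λ w → (Ez * Ez) * Ey + (- (Ez * B)) * w + (- (B * Ez)) * B + (B * B) * Ez) (energy-sym n y z) ⟩
        (Ez * Ez) * Ey + (- (Ez * B)) * B + (- (B * Ez)) * B + (B * B) * Ez
          ≡⟨ solve 3 (λ e b y → (e :* e) :* y :+ (:- (e :* b)) :* b :+ (:- (b :* e)) :* b :+ (b :* b) :* e := e :* (e :* y :- b :* b)) refl Ez B Ey ⟩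
        Ez * (Ez * Ey - B * B) ∎
    instance
      Ez-positive : Positive Ez
      Ez-positive = positive Ez>0
    gap≥0 : 0ℚ ≤ Ez * Ey - B * B
    gap≥0 = *-cancelˡ-≤-pos Ez (subst₂ _≤_ (sym (*-zeroʳ Ez)) expand (energy-nonneg n u))

  resistance-sym : ∀ n (X : Matrix n) a b → resistance n X a b ≡ resistance n X b a
  resistance-sym n X a b = ∑-cong n (λ i → ∑-cong n (λ j →
    solve 5 (λ ai bi x aj bj → ((ai :- bi) :* x) :* (aj :- bj) := ((bi :- ai) :* x) :* (bj :- aj)) refl (e a i) (e b i) (X i j) (e a j) (e b j)))

  resistance-from-potential : ∀ n (X : Matrix n) → IsGeneralisedInverse (laplacian n) X →
    ∀ (y : ℕ → ℚ) p q → p ℕ.< n → q ℕ.< n → Potential n p q y →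
    resistance n X (suc p) (suc q) ≡ y p - y q
  resistance-from-potential n X LXL≡L y p q p<n q<n hy = begin
      quadForm X (suc p) (suc q)
        ≡⟨ quadForm-dot X (suc p) (suc q) ⟩
      dot v (X ▷ v)
        ≡⟨ generalisedInverse-quadForm (laplacian n) X ŷ v (laplacian-sym n) LXL≡L (λ i → trans (laplacian-▷ n y i) (hy (toℕ i) (FinP.toℕ<n i))) ⟩
      dot ŷ v
        ≡⟨ ∑-toℕ n (λ i → y i * dipole p q i) ⟩
      ∑ℕ n (λ i → y i * dipole p q i)
        ≡⟨ ∑ℕ-*-dipole n y p q p<n q<n ⟩
      y p - y q ∎
    where
    open ≡-Reasoning
    v : Fin n → ℚ
    v i = e (suc p) i - e (suc q) i
    ŷ : Fin n → ℚ
    ŷ i = y (toℕ i)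

  energy-potential : ∀ n (y z : ℕ → ℚ) p q → p ℕ.< n → q ℕ.< n → Potential n p q y →
    energy n z y ≡ z p - z q
  energy-potential n y z p q p<n q<n hy = trans (∑ℕ-cong n (λ i i<n → cong (z i *_) (hy i i<n))) (∑ℕ-*-dipole n z p q p<n q<n)

  n≡m+[n∸m] : ∀ {m n} → m ℕ.≤ n → n ≡ m ℕ.+ (n ∸ m)
  n≡m+[n∸m] p = sym (ℕP.m+[n∸m]≡n p)

  -- Pairs at distance at least three

  rightNbrs-cong : ∀ n i {g h : ℕ → ℚ} → g (suc i) ≡ h (suc i) → g (suc (suc i)) ≡ h (suc (suc i)) → rightNbrs n i g ≡ rightNbrs n i h
  rightNbrs-cong n i e1 e2 = cong₂ _+_ (cong (when (suc i <ᵇ n)) e1) (cong (when (suc (suc i) <ᵇ n)) e2)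

  boolℕ : Bool → ℕ
  boolℕ true = 1
  boolℕ false = 0

  leftDeg : ℕ → ℕ
  leftDeg zero = 0
  leftDeg (suc zero) = 1
  leftDeg (suc (suc i)) = 2

  degree : ℕ → ℕ → ℕ
  degree n i = leftDeg i ℕ.+ (boolℕ (suc i <ᵇ n) ℕ.+ boolℕ (suc (suc i) <ᵇ n))

  when-1 : ∀ b → when b 1ℚ ≡ ι (boolℕ b)
  when-1 true = refl
  when-1 false = refl

  leftNbrs-1 : ∀ i → leftNbrs i (λ _ → 1ℚ) ≡ ι (leftDeg i)
  leftNbrs-1 zero = refl
  leftNbrs-1 (suc zero) = refl
  leftNbrs-1 (suc (suc i)) = refl

  nbrs-1 : ∀ n i → leftNbrs i (λ _ → 1ℚ) + rightNbrs n i (λ _ → 1ℚ) ≡ ι (degree n i)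
  nbrs-1 n i = trans (cong₂ _+_ (leftNbrs-1 i) (cong₂ _+_ (when-1 (suc i <ᵇ n)) (when-1 (suc (suc i) <ᵇ n))))
     (sym (trans (ι-+ (leftDeg i) _) (cong (ι (leftDeg i) +_) (ι-+ (boolℕ (suc i <ᵇ n)) (boolℕ (suc (suc i) <ᵇ n))))))

  boolℕ≤1 : ∀ b → boolℕ b ℕ.≤ 1
  boolℕ≤1 true = s≤s z≤n
  boolℕ≤1 false = z≤n

  leftDeg≤2 : ∀ i → leftDeg i ℕ.≤ 2
  leftDeg≤2 zero = z≤n
  leftDeg≤2 (suc zero) = s≤s z≤n
  leftDeg≤2 (suc (suc i)) = ℕP.≤-refl

  degree≤4 : ∀ n i → degree n i ℕ.≤ 4
  degree≤4 n i = ℕP.+-mono-≤ (leftDeg≤2 i) (ℕP.+-mono-≤ (boolℕ≤1 (suc i <ᵇ n)) (boolℕ≤1 (suc (suc i) <ᵇ n)))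

  degree≥2 : ∀ n i → 2 ℕ.≤ i → 2 ℕ.≤ degree n i
  degree≥2 n (suc (suc i)) _ = ℕP.m≤m+n 2 _
  degree≥2 n (suc zero) (s≤s ())

  adjacent⇒≢ : ∀ {i k} → adjacent i k ≡ true → k ≢ i
  adjacent⇒≢ {i} adj refl with trans (sym (adjacent-irrefl i)) adj
  ... | ()

  lap-eℕ-self : ∀ n i → i ℕ.< n → lap n (eℕ (suc i)) i ≡ ι (degree n i)
  lap-eℕ-self n i i<n = begin
      lap n (eℕ (suc i)) i
        ≡⟨ lap-nbrs n (eℕ (suc i)) i i<n ⟩
      leftNbrs i (λ k → eℕ (suc i) i - eℕ (suc i) k) + rightNbrs n i (λ k → eℕ (suc i) i - eℕ (suc i) k)
        ≡⟨ cong₂ _+_ (leftNbrs-cong i (λ k k<i → drop≡1 (ℕP.<⇒≢ k<i)))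
                     (rightNbrs-cong n i {λ k → eℕ (suc i) i - eℕ (suc i) k} {λ _ → 1ℚ} (drop≡1 ℕP.1+n≢n) (drop≡1 (λ e → ℕP.<⇒≢ (ℕP.m<n+m i {2} (s≤s z≤n)) (sym e)))) ⟩
      leftNbrs i (λ _ → 1ℚ) + rightNbrs n i (λ _ → 1ℚ)
        ≡⟨ nbrs-1 n i ⟩
      ι (degree n i) ∎
    where
    open ≡-Reasoning
    drop≡1 : ∀ {k} → k ≢ i → eℕ (suc i) i - eℕ (suc i) k ≡ 1ℚ
    drop≡1 k≢i = cong₂ _-_ (eℕ-same i) (eℕ-≢ k≢i)

  lap-concentrated : ∀ n (z : ℕ → ℚ) i c → i ℕ.< n → z i ≡ c → (∀ k → adjacent i k ≡ true → z k ≡ 0ℚ) →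
                     lap n z i ≡ c * ι (degree n i)
  lap-concentrated n z i c i<n zi nbrs = begin
      lap n z i
        ≡⟨ lap-local n i z (λ k → c * eℕ (suc i) k) (trans zi (sym c*1)) (λ k adj → trans (nbrs k adj) (sym (c*0 (adjacent⇒≢ adj)))) ⟩
      lap n (λ k → c * eℕ (suc i) k) i
        ≡⟨ lap-scale n (eℕ (suc i)) c i ⟩
      c * lap n (eℕ (suc i)) i
        ≡⟨ cong (c *_) (lap-eℕ-self n i i<n) ⟩
      c * ι (degree n i) ∎
    where
    open ≡-Reasoning
    c*1 : c * eℕ (suc i) i ≡ c
    c*1 = trans (cong (c *_) (eℕ-same i)) (*-identityʳ c)
    c*0 : ∀ {k} → k ≢ i → c * eℕ (suc i) k ≡ 0ℚ
    c*0 k≢i = trans (cong (c *_) (eℕ-≢ k≢i)) (*-zeroʳ c)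

  energy-dipole-far : ∀ n p q → 3 ℕ.+ p ℕ.≤ q → q ℕ.< n → energy n (dipole p q) (dipole p q) ≡ ι (degree n p ℕ.+ degree n q)
  energy-dipole-far n p q p+3≤q q<n = begin
      ∑ℕ n (λ i → z i * lap n z i)
        ≡⟨ ∑ℕ-cong n (λ i _ → *-comm (z i) (lap n z i)) ⟩
      ∑ℕ n (λ i → lap n z i * z i)
        ≡⟨ ∑ℕ-*-dipole n (lap n z) p q p<n q<n ⟩
      lap n z p - lap n z q
        ≡⟨ cong₂ _-_ (lap-concentrated n z p 1ℚ p<n (dipole-source p≢q) nbrs-p) (lap-concentrated n z q (- 1ℚ) q<n (dipole-sink p≢q) nbrs-q) ⟩
      1ℚ * ι (degree n p) - (- 1ℚ) * ι (degree n q)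
        ≡⟨ solve 2 (λ x y → con 1ℚ :* x :- (:- con 1ℚ) :* y := x :+ y) refl (ι (degree n p)) (ι (degree n q)) ⟩
      ι (degree n p) + ι (degree n q)
        ≡⟨ sym (ι-+ (degree n p) (degree n q)) ⟩
      ι (degree n p ℕ.+ degree n q) ∎
    where
    open ≡-Reasoning
    z = dipole p q
    p<q : p ℕ.< q
    p<q = ℕP.<-≤-trans (ℕP.m<n+m p {3} (s≤s z≤n)) p+3≤q
    p≢q = ℕP.<⇒≢ p<q
    p<n : p ℕ.< n
    p<n = ℕP.<-trans p<q q<n
    nbrs-p : ∀ k → adjacent p k ≡ true → z k ≡ 0ℚ
    nbrs-p k adj = dipole-≢ (adjacent⇒≢ adj) (ℕP.<⇒≢ (ℕP.≤-<-trans (proj₁ (adjacent⇒near p k adj)) p+3≤q))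
    nbrs-q : ∀ k → adjacent q k ≡ true → z k ≡ 0ℚ
    nbrs-q k adj = dipole-≢ (λ k≡p → ℕP.<⇒≱ p+3≤q (subst (λ t → q ℕ.≤ 2 ℕ.+ t) k≡p (proj₂ (adjacent⇒near q k adj)))) (adjacent⇒≢ adj)

  potential-drop-cauchySchwarz : ∀ n (y z : ℕ → ℚ) p q → p ℕ.< n → q ℕ.< n →
    Potential n p q y → 0ℚ < energy n z z →
    (z p - z q) * (z p - z q) ≤ energy n z z * (y p - y q)
  potential-drop-cauchySchwarz n y z p q p<n q<n hy Ez>0 =
    subst₂ _≤_ (cong₂ _*_ Ezy Ezy) (cong (energy n z z *_) (energy-potential n y y p q p<n q<n hy)) (energy-cauchySchwarz n y z Ez>0)
    where
    Ezy = energy-potential n y z p q p<n q<n hy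

  potential-drop-far : ∀ n (y : ℕ → ℚ) p q → 3 ℕ.+ p ℕ.≤ q → q ℕ.< n →
    Potential n p q y → ½ ≤ y p - y q
  potential-drop-far n y p q p+3≤q q<n hy = begin
      ½
        ≡⟨ refl ⟩
      ⅛ * ((1ℚ + 1ℚ) * (1ℚ + 1ℚ))
        ≤⟨ *-monoˡ-≤-nonNeg ⅛ {{normalize-nonNeg 1 8}} (≤-trans CS (*-monoʳ-≤-nonNeg r {{nonNegative r≥0}} (ι-mono E≤8))) ⟩
      ⅛ * (ι 8 * r)
        ≡⟨ solve 1 (λ x → con ⅛ :* (con (ι 8) :* x) := x) refl r ⟩
      r ∎
    where
    open ≤-Reasoning
    ⅛ = ℤ.+ 1 / 8
    r = y p - y q
    p<q : p ℕ.< q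
    p<q = ℕP.<-≤-trans (ℕP.m<n+m p {3} (s≤s z≤n)) p+3≤q
    p<n : p ℕ.< n
    p<n = ℕP.<-trans p<q q<n
    E = degree n p ℕ.+ degree n q
    Ez≡ = energy-dipole-far n p q p+3≤q q<n
    E≤8 : E ℕ.≤ 8
    E≤8 = ℕP.+-mono-≤ (degree≤4 n p) (degree≤4 n q)
    E>0 : 0ℚ < ι E
    E>0 = <-≤-trans (positive⁻¹ 1ℚ) (ι-mono (ℕP.≤-trans (s≤s z≤n) (ℕP.≤-trans (degree≥2 n q (ℕP.≤-trans (s≤s (s≤s z≤n)) p+3≤q)) (ℕP.m≤n+m (degree n q) (degree n p)))))
    r≥0 : 0ℚ ≤ r
    r≥0 = subst (0ℚ ≤_) (energy-potential n y y p q p<n q<n hy) (energy-nonneg n y)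
    CS : (1ℚ + 1ℚ) * (1ℚ + 1ℚ) ≤ ι E * r
    CS = subst₂ (λ s t → s * s ≤ t * r) (dipole-drop (ℕP.<⇒≢ p<q)) Ez≡
           (potential-drop-cauchySchwarz n y (dipole p q) p q p<n q<n hy (subst (0ℚ <_) (sym Ez≡) E>0))

  telescopePotential : ℕ → ℕ → ℕ → ℕ → ℚ
  telescopePotential n p zero k = 0ℚ
  telescopePotential n p (suc L) k = telescopePotential n p L k + adjPotential (p ℕ.+ L) (n ∸ suc (suc (p ℕ.+ L))) k

  lap-telescopePotential : ∀ n p L → p ℕ.+ L ℕ.< n → Potential n p (p ℕ.+ L) (telescopePotential n p L)
  lap-telescopePotential n p zero _ i _ = begin
      lap n (λ _ → 0ℚ) i
        ≡⟨ ∑ℕ-zero n (λ k → *-zeroʳ (adjℚ i k)) ⟩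
      0ℚ
        ≡⟨ sym (+-inverseʳ (eℕ (suc p) i)) ⟩
      dipole p p i
        ≡⟨ cong (λ t → dipole p t i) (sym (ℕP.+-identityʳ p)) ⟩
      dipole p (p ℕ.+ 0) i ∎
    where open ≡-Reasoning
  lap-telescopePotential n p (suc L) p+L+1<n i i<n = begin
      lap n (λ k → telescopePotential n p L k + adjPotential j b k) i
        ≡⟨ lap-+ n (telescopePotential n p L) (adjPotential j b) i ⟩
      lap n (telescopePotential n p L) i + lap n (adjPotential j b) i
        ≡⟨ cong₂ _+_ (lap-telescopePotential n p L (ℕP.<-trans (ℕP.+-monoʳ-< p (ℕP.n<1+n L)) p+L+1<n) i i<n)
                     (subst (λ N → Potential N j (suc j) (adjPotential j b)) (sym n≡) (lap-adjPotential j b) i i<n) ⟩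
      dipole p j i + dipole j (suc j) i
        ≡⟨ solve 3 (λ x y z → (x :- y) :+ (y :- z) := x :- z) refl (eℕ (suc p) i) (eℕ (suc j) i) (eℕ (suc (suc j)) i) ⟩
      dipole p (suc j) i
        ≡⟨ cong (λ z → dipole p z i) (sym (ℕP.+-suc p L)) ⟩
      dipole p (p ℕ.+ suc L) i ∎
    where
    open ≡-Reasoning
    j = p ℕ.+ L
    b = n ∸ suc (suc j)
    n≡ : n ≡ suc (suc (j ℕ.+ b))
    n≡ = n≡m+[n∸m] (subst (ℕ._< n) (ℕP.+-suc p L) p+L+1<n)

  resistance-far : ∀ n (X : Matrix n) → IsGeneralisedInverse (laplacian n) X →
                   ∀ p q → 3 ℕ.+ p ℕ.≤ q → q ℕ.< n → ½ ≤ resistance n X (suc p) (suc q)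
  resistance-far n X LXL≡L p q p+3≤q q<n =
    subst (½ ≤_) (sym (resistance-from-potential n X LXL≡L y p q p<n q<n hy)) (potential-drop-far n y p q p+3≤q q<n hy)
    where
    p≤q : p ℕ.≤ q
    p≤q = ℕP.≤-trans (ℕP.m≤n+m p 3) p+3≤q
    p<n : p ℕ.< n
    p<n = ℕP.≤-<-trans p≤q q<n
    y = telescopePotential n p (q ∸ p)
    hy : Potential n p q y
    hy i i<n = trans (lap-telescopePotential n p (q ∸ p) (subst (ℕ._< n) (sym (ℕP.m+[n∸m]≡n p≤q)) q<n) i i<n)
                     (cong (λ t → dipole p t i) (ℕP.m+[n∸m]≡n p≤q))

  -- The minimum

  balanced-≤½ : ∀ c d → (d ≡ c ⊎ d ≡ suc c) → 2 ℕ.≤ c ℕ.+ d → ι (oddFibProd c d) * invFib c d ≤ ½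
  balanced-≤½ zero zero _ ()
  balanced-≤½ zero (suc zero) _ (s≤s ())
  balanced-≤½ zero (suc (suc d)) (inj₁ ())
  balanced-≤½ zero (suc (suc d)) (inj₂ ())
  balanced-≤½ (suc c) zero (inj₁ ())
  balanced-≤½ (suc c) zero (inj₂ ())
  balanced-≤½ (suc c) (suc d) _ _ = begin
      r
        ≡⟨ solve 1 (λ m → m := con ½ :* ((con 1ℚ :+ con 1ℚ) :* m)) refl r ⟩
      ½ * ((1ℚ + 1ℚ) * r)
        ≡⟨ cong (½ *_) (sym ι2G) ⟩
      ½ * (ι (2 ℕ.* G) * o)
        ≤⟨ *-monoˡ-≤-nonNeg ½ {{normalize-nonNeg 1 2}} (≤-trans (*-monoʳ-≤-nonNeg o {{invFib-nonneg (suc c) (suc d)}} (ι-mono (oddFibProd-half c d))) (≤-reflexive F*invF≡1)) ⟩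
      ½ * 1ℚ
        ≡⟨ *-identityʳ ½ ⟩
      ½ ∎
    where
    open ≤-Reasoning
    G = oddFibProd (suc c) (suc d)
    o = invFib (suc c) (suc d)
    r = ι G * o
    F*invF≡1 : ι (fib (suc (suc ((suc c ℕ.+ suc d) ℕ.+ (suc c ℕ.+ suc d))))) * o ≡ 1ℚ
    F*invF≡1 = trans (*-comm _ o) (trans (cong (o *_) (sym (fibℚ-ι _))) (oneOverFibSuc-*-fibℚ (fibIdx (suc c) (suc d))))
    ι2G : ι (2 ℕ.* G) * o ≡ (1ℚ + 1ℚ) * r
    ι2G = trans (cong (_* o) (ι-* 2 G)) (trans (*-assoc (ι 2) (ι G) o) refl)

  module Balanced (n : ℕ) (X : Matrix n) (LXL≡L : IsGeneralisedInverse (laplacian n) X)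
              (c d : ℕ) (n≡ : n ≡ suc (suc (c ℕ.+ d))) (balanced : d ≡ c ⊎ d ≡ suc c) where

    invF : ℚ
    invF = invFib c d

    r₀ : ℚ
    r₀ = ι (oddFibProd c d) * invF

    size-split : ∀ a b → n ≡ suc (suc (a ℕ.+ b)) → a ℕ.+ b ≡ c ℕ.+ d
    size-split a b e = ℕP.suc-injective (ℕP.suc-injective (trans (sym e) n≡))

    invFib-size : ∀ a b → a ℕ.+ b ≡ c ℕ.+ d → invFib a b ≡ invF
    invFib-size a b e = cong (λ z → oneOverFibSuc (suc (z ℕ.+ z))) e

    ι-*-invF-mono : ∀ {x y} → x ℕ.≤ y → ι x * invF ≤ ι y * invF
    ι-*-invF-mono p = *-monoʳ-≤-nonNeg invF {{invFib-nonneg c d}} (ι-mono p)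

    adjacent-in-range : ∀ a b → n ≡ suc (suc (a ℕ.+ b)) → a ℕ.< n × suc a ℕ.< n
    adjacent-in-range a b e = subst (a ℕ.<_) (sym e) (s≤s (ℕP.≤-trans (ℕP.m≤m+n a b) (ℕP.n≤1+n _))) ,
                 subst (suc a ℕ.<_) (sym e) (s≤s (s≤s (ℕP.m≤m+n a b)))

    resistance-adjacent : ∀ a b → n ≡ suc (suc (a ℕ.+ b)) → resistance n X (suc a) (suc (suc a)) ≡ ι (oddFibProd a b) * invF
    resistance-adjacent a b e = begin
        resistance n X (suc a) (suc (suc a))
          ≡⟨ resistance-from-potential n X LXL≡L (adjPotential a b) a (suc a) (proj₁ (adjacent-in-range a b e)) (proj₂ (adjacent-in-range a b e))
               (subst (λ N → Potential N a (suc a) (adjPotential a b)) (sym e) (lap-adjPotential a b)) ⟩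
        adjPotential a b a - adjPotential a b (suc a)
          ≡⟨ adjPotential-drop a b ⟩
        (fibℚ (suc (a ℕ.+ a)) * fibℚ (suc (b ℕ.+ b))) * invFib a b
          ≡⟨ cong₂ _*_ (fibℚ-* (suc (a ℕ.+ a)) (suc (b ℕ.+ b))) (invFib-size a b (size-split a b e)) ⟩
        ι (oddFibProd a b) * invF ∎
      where open ≡-Reasoning

    dist2Numerator : ℕ → ℕ → ℕ
    dist2Numerator a b = fib (suc (a ℕ.+ a)) ℕ.* fib (suc (suc (b ℕ.+ b))) ℕ.+ fib (suc (suc (a ℕ.+ a))) ℕ.* fib (suc (b ℕ.+ b))

    resistance-dist2 : ∀ a b → n ≡ suc (suc (a ℕ.+ suc b)) → resistance n X (suc a) (suc (suc (suc a))) ≡ ι (dist2Numerator a b) * invF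
    resistance-dist2 a b e = begin
        resistance n X (suc a) (suc (suc (suc a)))
          ≡⟨ resistance-from-potential n X LXL≡L (dist2Potential a b) a (suc (suc a)) a<n ssa<n
               (subst (λ N → Potential N a (suc (suc a)) (dist2Potential a b)) (sym e) (lap-dist2Potential a b)) ⟩
        dist2Potential a b a - dist2Potential a b (suc (suc a))
          ≡⟨ dist2Potential-drop a b ⟩
        (fibℚ (suc (a ℕ.+ a)) * fibℚ (suc (suc (b ℕ.+ b))) + fibℚ (suc (suc (a ℕ.+ a))) * fibℚ (suc (b ℕ.+ b))) * invFib a (suc b)
          ≡⟨ cong₂ _*_ (trans (cong₂ _+_ (fibℚ-* (suc (a ℕ.+ a)) (suc (suc (b ℕ.+ b)))) (fibℚ-* (suc (suc (a ℕ.+ a))) (suc (b ℕ.+ b)))) (sym (ι-+ (fib (suc (a ℕ.+ a)) ℕ.* fib (suc (suc (b ℕ.+ b)))) (fib (suc (suc (a ℕ.+ a))) ℕ.* fib (suc (b ℕ.+ b)))))) (invFib-size a (suc b) (size-split a (suc b) e)) ⟩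
        ι (dist2Numerator a b) * invF ∎
      where
      open ≡-Reasoning
      ssa<n : suc (suc a) ℕ.< n
      ssa<n = subst (suc (suc a) ℕ.<_) (sym e) (s≤s (s≤s (ℕP.≤-trans (s≤s (ℕP.m≤m+n a b)) (ℕP.≤-reflexive (sym (ℕP.+-suc a b))))))
      a<n : a ℕ.< n
      a<n = ℕP.<-trans (ℕP.n<1+n a) (ℕP.<-trans (ℕP.n<1+n (suc a)) ssa<n)

    size≥2 : ∀ q → 3 ℕ.≤ q → q ℕ.< n → 2 ℕ.≤ c ℕ.+ d
    size≥2 q 3≤q q<n = ℕP.≤-pred (ℕP.≤-pred (ℕP.≤-trans (s≤s 3≤q) (ℕP.≤-trans q<n (ℕP.≤-reflexive n≡))))

    resistance-min-< : ∀ p q → p ℕ.< q → q ℕ.< n → r₀ ≤ resistance n X (suc p) (suc q)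
    resistance-min-< p q p<q q<n with ℕP.m≤n⇒m<n∨m≡n p<q
    ... | inj₂ refl = subst (r₀ ≤_) (sym (resistance-adjacent p b n≡′)) (ι-*-invF-mono (oddFibProd-min c d p b balanced (size-split p b n≡′)))
      where
      b = n ∸ suc (suc p)
      n≡′ : n ≡ suc (suc (p ℕ.+ b))
      n≡′ = n≡m+[n∸m] q<n
    ... | inj₁ sp<q with ℕP.m≤n⇒m<n∨m≡n sp<q
    ...   | inj₂ refl = subst (r₀ ≤_) (sym (resistance-dist2 p b n≡′)) (≤-trans (ι-*-invF-mono (oddFibProd-min c d p (suc b) balanced (size-split p (suc b) n≡′))) (ι-*-invF-mono (oddFibProd-dist2 p b)))
      where
      b = n ∸ suc (suc (suc p))
      n≡′ : n ≡ suc (suc (p ℕ.+ suc b))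
      n≡′ = trans (n≡m+[n∸m] q<n) (cong (λ z → suc (suc z)) (sym (ℕP.+-suc p b)))
    ...   | inj₁ ssp<q = ≤-trans (balanced-≤½ c d balanced (size≥2 q (ℕP.≤-trans (s≤s (s≤s (s≤s z≤n))) ssp<q) q<n)) (resistance-far n X LXL≡L p q ssp<q q<n)

    resistance-min : ∀ a b → 1 ℕ.≤ a → a ℕ.≤ n → 1 ℕ.≤ b → b ℕ.≤ n → a ≢ b → r₀ ≤ resistance n X a b
    resistance-min (suc p) (suc q) _ a≤n _ b≤n a≢b with ℕP.<-cmp p q
    ... | tri< p<q _ _ = resistance-min-< p q p<q b≤n
    ... | tri≈ _ refl _ = ⊥-elim (a≢b refl)
    ... | tri> _ _ q<p = subst (r₀ ≤_) (resistance-sym n X (suc q) (suc p)) (resistance-min-< q p q<p a≤n)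

    resistance-centre : resistance n X (suc c) (suc (suc c)) ≡ r₀
    resistance-centre = resistance-adjacent c d n≡

    resistance-centre′ : d ≡ suc c → resistance n X (suc (suc c)) (suc (suc (suc c))) ≡ r₀
    resistance-centre′ refl = trans (resistance-adjacent (suc c) c (trans n≡ (cong (λ z → suc (suc z)) (trans (ℕP.+-suc c c) refl))))
                   (cong (λ z → ι z * invF) (oddFibProd-sym (suc c) c))

  frac-cross : ∀ x y X Z .{{_ : ℕ.NonZero y}} .{{_ : ℕ.NonZero Z}} → x ℕ.* Z ≡ X ℕ.* y → frac x y ≡ ι X * frac 1 Z
  frac-cross x y X Z eq = begin
      frac x y
        ≡⟨ frac-split x y ⟩
      ι x * φ
        ≡⟨ sym (*-identityʳ (ι x * φ)) ⟩
      ι x * φ * 1ℚ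
        ≡⟨ cong (ι x * φ *_) (sym hz) ⟩
      ι x * φ * (ψ * ι Z)
        ≡⟨ solve 4 (λ a f p z → a :* f :* (p :* z) := (a :* z) :* f :* p) refl (ι x) φ ψ (ι Z) ⟩
      (ι x * ι Z) * φ * ψ
        ≡⟨ cong (λ t → t * φ * ψ) (trans (sym (ι-* x Z)) (trans (cong ι eq) (ι-* X y))) ⟩
      (ι X * ι y) * φ * ψ
        ≡⟨ solve 4 (λ a yy f p → (a :* yy) :* f :* p := a :* p :* (f :* yy)) refl (ι X) (ι y) φ ψ ⟩
      ι X * ψ * (φ * ι y)
        ≡⟨ cong (ι X * ψ *_) hy ⟩
      ι X * ψ * 1ℚ
        ≡⟨ *-identityʳ _ ⟩
      ι X * ψ ∎
    where
    open ≡-Reasoning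
    φ = frac 1 y
    ψ = frac 1 Z
    hy : φ * ι y ≡ 1ℚ
    hy = frac-*-ι 1 y
    hz : ψ * ι Z ≡ 1ℚ
    hz = frac-*-ι 1 Z

  fibOverLucas-even : ∀ c → fibOverLucas (suc (c ℕ.+ c)) ≡ ι (oddFibProd c c) * invFib c c
  fibOverLucas-even c = frac-cross x (lucas (suc (c ℕ.+ c))) (x ℕ.* x) Z {{lucas-nonZero (suc (c ℕ.+ c))}} {{fib-suc-nonZero (fibIdx c c)}} eq
    where
    x = fib (suc (c ℕ.+ c))
    Z = fib (suc (fibIdx c c))
    eq : x ℕ.* Z ≡ (x ℕ.* x) ℕ.* lucas (suc (c ℕ.+ c))
    eq = trans (cong (x ℕ.*_) (fib-add (suc (c ℕ.+ c)) (c ℕ.+ c))) (l x (fib (suc (suc (c ℕ.+ c)))) (fib (c ℕ.+ c)))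
      where
      l : ∀ x w v → x ℕ.* (w ℕ.* x ℕ.+ x ℕ.* v) ≡ (x ℕ.* x) ℕ.* (v ℕ.+ w)
      l = NS.solve-∀

  fibOverLucas-odd : ∀ c → fibOverLucas (suc c ℕ.+ suc c) + oneOverFibSuc (fibIdx c (suc c)) ≡ ι (oddFibProd c (suc c)) * invFib c (suc c)
  fibOverLucas-odd c = begin
      fibOverLucas (suc c ℕ.+ suc c) + ψ
        ≡⟨ cong₂ _+_ (frac-cross F Lh (F ℕ.* F) Z {{lucas-nonZero (suc c ℕ.+ suc c)}} {{fib-suc-nonZero (fibIdx c (suc c))}} eq) (sym (*-identityˡ ψ)) ⟩
      ι (F ℕ.* F) * ψ + ι 1 * ψ
        ≡⟨ sym (*-distribʳ-+ ψ (ι (F ℕ.* F)) (ι 1)) ⟩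
      (ι (F ℕ.* F) + ι 1) * ψ
        ≡⟨ cong (_* ψ) (sym (ι-+ (F ℕ.* F) 1)) ⟩
      ι (F ℕ.* F ℕ.+ 1) * ψ
        ≡⟨ cong (λ t → ι t * ψ) gEq ⟩
      ι (oddFibProd c (suc c)) * ψ ∎
    where
    open ≡-Reasoning
    m = c ℕ.+ suc c
    F = fib (suc m)
    Lh = lucas (suc c ℕ.+ suc c)
    Z = fib (suc (fibIdx c (suc c)))
    ψ = oneOverFibSuc (fibIdx c (suc c))
    eq : F ℕ.* Z ≡ (F ℕ.* F) ℕ.* Lh
    eq = trans (cong (F ℕ.*_) (fib-add (suc m) m)) (l F (fib (suc (suc m))) (fib m))
      where
      l : ∀ x w v → x ℕ.* (w ℕ.* x ℕ.+ x ℕ.* v) ≡ (x ℕ.* x) ℕ.* (v ℕ.+ w)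
      l = NS.solve-∀
    i1 : suc m ≡ suc (suc (c ℕ.+ c))
    i1 = cong suc (ℕP.+-suc c c)
    gEq : F ℕ.* F ℕ.+ 1 ≡ oddFibProd c (suc c)
    gEq = begin
        F ℕ.* F ℕ.+ 1
          ≡⟨ cong (λ t → fib t ℕ.* fib t ℕ.+ 1) i1 ⟩
        fib (suc (suc (c ℕ.+ c))) ℕ.* fib (suc (suc (c ℕ.+ c))) ℕ.+ 1
          ≡⟨ sym (cassini-even c) ⟩
        fib (suc (c ℕ.+ c)) ℕ.* fib (suc (suc (suc (c ℕ.+ c))))
          ≡⟨ cong (λ t → fib (suc (c ℕ.+ c)) ℕ.* fib (suc t)) (sym i1) ⟩
        oddFibProd c (suc c) ∎

  even-halves : ∀ k → (3 ℕ.+ k) ℕ.% 2 ≡ 0 → Σ[ c ∈ ℕ ] ((3 ℕ.+ k ≡ suc (suc (c ℕ.+ c))) × ((3 ℕ.+ k) ℕ./ 2 ≡ suc c))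
  even-halves k e with (3 ℕ.+ k) ℕ./ 2 in heq
  ... | zero = contra (trans (m≡m%n+[m/n]*n (3 ℕ.+ k) 2) (cong₂ (λ a b → a ℕ.+ b ℕ.* 2) e heq))
    where
    contra : 3 ℕ.+ k ≡ 0 → _
    contra ()
  ... | suc c = c , trans (m≡m%n+[m/n]*n (3 ℕ.+ k) 2) (trans (cong₂ (λ a b → a ℕ.+ b ℕ.* 2) e heq) (l c)) , refl
    where
    l : ∀ c → 0 ℕ.+ suc c ℕ.* 2 ≡ suc (suc (c ℕ.+ c))
    l = NS.solve-∀

  odd-halves : ∀ k → (3 ℕ.+ k) ℕ.% 2 ≡ 1 →
    Σ[ c ∈ ℕ ] ((3 ℕ.+ k ≡ suc (suc (c ℕ.+ suc c))) × (((3 ℕ.+ k) ∸ 1) ℕ./ 2 ≡ suc c) × ((3 ℕ.+ k ℕ.+ 1) ℕ./ 2 ≡ suc (suc c)) × ((3 ℕ.+ k ℕ.+ 3) ℕ./ 2 ≡ suc (suc (suc c))))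
  odd-halves k e with (3 ℕ.+ k) ℕ./ 2 in heq
  ... | zero = contra (trans (m≡m%n+[m/n]*n (3 ℕ.+ k) 2) (cong₂ (λ a b → a ℕ.+ b ℕ.* 2) e heq))
    where
    contra : 3 ℕ.+ k ≡ 1 → _
    contra ()
  ... | suc c = c , trans nE (l0 c) , trans (cong (λ m → (m ∸ 1) ℕ./ 2) nE) (m*n/n≡m (suc c) 2)
                  , trans (cong (λ m → (m ℕ.+ 1) ℕ./ 2) nE) (trans (cong (ℕ._/ 2) (l1 c)) (m*n/n≡m (suc (suc c)) 2))
                  , trans (cong (λ m → (m ℕ.+ 3) ℕ./ 2) nE) (trans (cong (ℕ._/ 2) (l2 c)) (m*n/n≡m (suc (suc (suc c))) 2))
    where
    nE : 3 ℕ.+ k ≡ 1 ℕ.+ suc c ℕ.* 2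
    nE = trans (m≡m%n+[m/n]*n (3 ℕ.+ k) 2) (cong₂ (λ a b → a ℕ.+ b ℕ.* 2) e heq)
    l0 : ∀ c → 1 ℕ.+ suc c ℕ.* 2 ≡ suc (suc (c ℕ.+ suc c))
    l0 = NS.solve-∀
    l1 : ∀ c → 1 ℕ.+ suc c ℕ.* 2 ℕ.+ 1 ≡ suc (suc c) ℕ.* 2
    l1 = NS.solve-∀
    l2 : ∀ c → 1 ℕ.+ suc c ℕ.* 2 ℕ.+ 3 ≡ suc (suc (suc c)) ℕ.* 2
    l2 = NS.solve-∀

  2n∸3 : ∀ x → 2 ℕ.* suc (suc x) ∸ 3 ≡ suc (x ℕ.+ x)
  2n∸3 x = cong (_∸ 3) (l x)
    where
    l : ∀ x → 2 ℕ.* suc (suc x) ≡ suc (suc (suc (suc (x ℕ.+ x))))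
    l = NS.solve-∀


open import Defs
open import Data.Nat using (ℕ; _≤_; _∸_; _%_; _/_) renaming (_+_ to _+ℕ_; _*_ to _*ℕ_)
open import Data.Rational using (ℚ; _+_) renaming (_≤_ to _≤ℚ_)
open import Data.Product using (_×_)
open import Relation.Binary.PropositionalEquality using (_≡_; _≢_)

open import Data.Nat using (suc)
import Data.Nat.Properties as ℕP
open import Data.Product using (_,_)
open import Data.Sum using (inj₁; inj₂)
open import Relation.Binary.PropositionalEquality using (refl; trans; sym; cong; cong₂; subst)

open LinearTwoTree

centre-even : ∀ k → let n = 3 +ℕ k in (X : Matrix n) → IsGeneralisedInverse (laplacian n) X →
  n % 2 ≡ 0 →
    (resistance n X (n / 2) (n / 2 +ℕ 1) ≡ fibOverLucas (n ∸ 1))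
    × (∀ a b → 1 ≤ a → a ≤ n → 1 ≤ b → b ≤ n → a ≢ b → fibOverLucas (n ∸ 1) ≤ℚ resistance n X a b)
centre-even k X LXL≡L even with even-halves k even
... | c , n≡ , n/2≡ = centre , minimal
  where
  n = 3 +ℕ k
  open Balanced n X LXL≡L c c n≡ (inj₁ refl)
  value≡ : fibOverLucas (n ∸ 1) ≡ r₀
  value≡ = trans (cong (λ m → fibOverLucas (m ∸ 1)) n≡) (fibOverLucas-even c)
  centre : resistance n X (n / 2) (n / 2 +ℕ 1) ≡ fibOverLucas (n ∸ 1)
  centre = trans (cong₂ (resistance n X) n/2≡ (trans (cong (_+ℕ 1) n/2≡) (ℕP.+-comm (suc c) 1)))
                 (trans resistance-centre (sym value≡))
  minimal : ∀ a b → 1 ≤ a → a ≤ n → 1 ≤ b → b ≤ n → a ≢ b → fibOverLucas (n ∸ 1) ≤ℚ resistance n X a b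
  minimal a b 1≤a a≤n 1≤b b≤n a≢b = subst (_≤ℚ resistance n X a b) (sym value≡) (resistance-min a b 1≤a a≤n 1≤b b≤n a≢b)

centre-odd : ∀ k → let n = 3 +ℕ k in (X : Matrix n) → IsGeneralisedInverse (laplacian n) X →
  n % 2 ≡ 1 →
    (resistance n X ((n ∸ 1) / 2) ((n +ℕ 1) / 2) ≡ fibOverLucas (n ∸ 1) + oneOverFibSuc (2 *ℕ n ∸ 3))
    × (resistance n X ((n +ℕ 1) / 2) ((n +ℕ 3) / 2) ≡ fibOverLucas (n ∸ 1) + oneOverFibSuc (2 *ℕ n ∸ 3))
    × (∀ a b → 1 ≤ a → a ≤ n → 1 ≤ b → b ≤ n → a ≢ b →
         fibOverLucas (n ∸ 1) + oneOverFibSuc (2 *ℕ n ∸ 3) ≤ℚ resistance n X a b)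
centre-odd k X LXL≡L odd with odd-halves k odd
... | c , n≡ , [n-1]/2≡ , [n+1]/2≡ , [n+3]/2≡ = left , right , minimal
  where
  n = 3 +ℕ k
  open Balanced n X LXL≡L c (suc c) n≡ (inj₂ refl)
  value≡ : fibOverLucas (n ∸ 1) + oneOverFibSuc (2 *ℕ n ∸ 3) ≡ r₀
  value≡ = trans (cong₂ _+_ (cong (λ m → fibOverLucas (m ∸ 1)) n≡) (cong oneOverFibSuc (trans (cong (λ m → 2 *ℕ m ∸ 3) n≡) (2n∸3 (c +ℕ suc c)))))
                 (fibOverLucas-odd c)
  left : resistance n X ((n ∸ 1) / 2) ((n +ℕ 1) / 2) ≡ fibOverLucas (n ∸ 1) + oneOverFibSuc (2 *ℕ n ∸ 3)
  left = trans (cong₂ (resistance n X) [n-1]/2≡ [n+1]/2≡) (trans resistance-centre (sym value≡))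
  right : resistance n X ((n +ℕ 1) / 2) ((n +ℕ 3) / 2) ≡ fibOverLucas (n ∸ 1) + oneOverFibSuc (2 *ℕ n ∸ 3)
  right = trans (cong₂ (resistance n X) [n+1]/2≡ [n+3]/2≡) (trans (resistance-centre′ refl) (sym value≡))
  minimal : ∀ a b → 1 ≤ a → a ≤ n → 1 ≤ b → b ≤ n → a ≢ b →
            fibOverLucas (n ∸ 1) + oneOverFibSuc (2 *ℕ n ∸ 3) ≤ℚ resistance n X a b
  minimal a b 1≤a a≤n 1≤b b≤n a≢b = subst (_≤ℚ resistance n X a b) (sym value≡) (resistance-min a b 1≤a a≤n 1≤b b≤n a≢b)

corollary6p4 : (k : ℕ) → let n = 3 +ℕ k in
    (X : Matrix n) → IsMoorePenroseInverse (laplacian n) X →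
      (n % 2 ≡ 0 →
        (resistance n X (n / 2) (n / 2 +ℕ 1) ≡ fibOverLucas (n ∸ 1))
        × (∀ a b → 1 ≤ a → a ≤ n → 1 ≤ b → b ≤ n → a ≢ b →
             fibOverLucas (n ∸ 1) ≤ℚ resistance n X a b))
      × (n % 2 ≡ 1 →
        (resistance n X ((n ∸ 1) / 2) ((n +ℕ 1) / 2)
           ≡ fibOverLucas (n ∸ 1) + oneOverFibSuc (2 *ℕ n ∸ 3))
        × (resistance n X ((n +ℕ 1) / 2) ((n +ℕ 3) / 2)
           ≡ fibOverLucas (n ∸ 1) + oneOverFibSuc (2 *ℕ n ∸ 3))
        × (∀ a b → 1 ≤ a → a ≤ n → 1 ≤ b → b ≤ n → a ≢ b →
             fibOverLucas (n ∸ 1) + oneOverFibSuc (2 *ℕ n ∸ 3) ≤ℚ resistance n X a b))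
corollary6p4 k X (LXL≡L , _) = centre-even k X LXL≡L , centre-odd k X LXL≡L
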